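{- Let $m\ge 1$ and let $n_1, \ldots, n_m \geq 2$ be even integers, and let $M$ be the complement of a $(2 ; n_1, \ldots, n_m)$ circulant block diagonal matrix. Put $n = \sum_{i=1}^{m}{n_i}$, and suppose that $n_i >2$ for some $i \in [m]$. Then $\mathrm{rank}_{\mathrm{bin}}(M) = n-m+1$.
   Context: For integers $n \ge k \ge 0$, $D_{n,k}$ denotes the $n\times n$ circulant $0,1$ matrix whose first row consists of $n-k$ ones followed by $k$ zeros, each subsequent row being the cyclic shift of the previous row by one position to the right. For integers $n_i\ge 2$, a $(2;n_1,\ldots,n_m)$ circulant block diagonal matrix is a block matrix with $m$ diagonal blocks whose $i$th diagonal block is $D_{n_i,n_i-2}$ (first row: two ones followed by $n_i-2$ zeros) and all of whose other entries are zero. The complement of a $0,1$ matrix is obtained by swapping zeros and ones. The binary rank $\mathrm{rank}_{\mathrm{bin}}(A)$ is the smallest number of combinatorial rectangles (all-one submatrices indexed by a set of rows times a set of columns) that partition the ones of $A$. -}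

module Defs where

open import Data.Bool using (Bool; true; false; not; if_then_else_; _∧_)
open import Data.Nat using (ℕ; zero; suc; _+_; _∸_; _<_; _<ᵇ_; _%_)
open import Data.Fin using (Fin; toℕ)
open import Data.Fin.Subset using (Subset)
open import Data.Vec using (Vec; []; _∷_; lookup; length)
open import Data.Product using (_×_; _,_; proj₁; proj₂)
open import Relation.Binary.PropositionalEquality using (_≡_)

-- 0,1 matrices are Bool-valued functions (true = 1).
Matrix : ℕ → ℕ → Set
Matrix r c = Fin r → Fin c → Bool

-- Entry (r , c) (0-based) of the circulant D_{n,k}: first row has n-k ones then
-- k zeros, row r is the first row cyclically shifted r positions to the right,
-- so entry (r , c) is 1 iff (c - r) mod n < n - k.
Dentry : ℕ → ℕ → ℕ → ℕ → Bool
Dentry zero    k r c = false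
Dentry (suc p) k r c = ((c + suc p ∸ r) % suc p) <ᵇ (suc p ∸ k)

-- Entry (r , c) (0-based, as naturals) of the block diagonal matrix whose
-- diagonal blocks are D_{n_i, n_i - 2} for the successive sizes n_i.
blockEntry : ∀ {m} → Vec ℕ m → ℕ → ℕ → Bool
blockEntry []       r c = false
blockEntry (k ∷ ks) r c =
  if r <ᵇ k
  then (if c <ᵇ k then Dentry k (k ∸ 2) r c else false)
  else (if c <ᵇ k then false else blockEntry ks (r ∸ k) (c ∸ k))

sumV : ∀ {m} → Vec ℕ m → ℕ
sumV []       = 0
sumV (k ∷ ks) = k + sumV ks

circBlockDiag2 : ∀ {m} (ns : Vec ℕ m) → Matrix (sumV ns) (sumV ns)
circBlockDiag2 ns i j = blockEntry ns (toℕ i) (toℕ j)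

complement : ∀ {r c} → Matrix r c → Matrix r c
complement A i j = not (A i j)

Rect : ℕ → ℕ → Set
Rect r c = Subset r × Subset c

inRect : ∀ {r c} → Rect r c → Fin r → Fin c → Bool
inRect (R , C) i j = lookup R i ∧ lookup C j

cover : ∀ {r c k} → Vec (Rect r c) k → Fin r → Fin c → ℕ
cover []       i j = 0
cover (X ∷ Xs) i j = (if inRect X i j then 1 else 0) + cover Xs i j

-- The rectangles partition the ones of A: every 1-entry lies in exactly one
-- rectangle, every 0-entry lies in none (so each rectangle is all-one).
IsPartition : ∀ {r c k} → Matrix r c → Vec (Rect r c) k → Set
IsPartition A Xs = ∀ i j → cover Xs i j ≡ (if A i j then 1 else 0)

open import Data.Nat using (_≤_)
open import Data.Product using (∃)

BinRankIs : ∀ {r c} → Matrix r c → ℕ → Set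
BinRankIs {r} {c} A b =
  (∃ λ (Xs : Vec (Rect r c) b) → IsPartition A Xs) ×
  (∀ k (Xs : Vec (Rect r c) k) → IsPartition A Xs → b ≤ k)

-- Index the n rows and columns blockwise, so that row r of M has zeros exactly in columns r and r + 1
-- of its block (cyclically).
-- Upper bound: for each column pair {t, t + 1} take the rectangle formed by these two columns and
-- suitable rows chosen by parity of the position within the block; the m rectangles of the pairs
-- starting a block share their rows and merge into one, leaving n - m + 1 rectangles.
-- Lower bound: a partition into k rectangles is a factorisation M = U Vᵀ with 0,1 matrices. The kernel
-- of M is spanned by the m blockwise alternating vectors, so k ≥ rank M = n - m, and a linear dependence
-- among the columns of U or of V improves this to k ≥ n - m + 1. If there is none, every column u_s of U
-- is orthogonal to the left kernel of M, so M y_s = 2(n - 2) u_s for an integer vector y_s, and the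
-- independence of the u_t forces v_s · y_s = 2(n - 2). Then the area |u_s| |v_s| of each rectangle is a
-- positive multiple of 2(n - 2), and since M has n(n - 2) ones, k ≤ n / 2, contradicting k ≥ n - m
-- because some block has size at least 4.

module Submission where

open import Defs
open import Data.Bool using (Bool; true; false; not; if_then_else_; _∧_; _∨_; _xor_)
open import Data.Empty using (⊥; ⊥-elim)
open import Data.Fin as Fin using (Fin; toℕ; fromℕ<)
import Data.Fin.Properties as Finₚ
open import Data.Integer as ℤ using (ℤ; 0ℤ; 1ℤ)
import Data.Integer.Properties as ℤₚ
open import Data.Integer.Tactic.RingSolver using (solve-∀)
open import Data.List using (List; []; _∷_; map; length; _++_)
import Data.List.Properties as Listₚ
open import Data.List.Relation.Unary.All as All using (All; []; _∷_)
import Data.List.Relation.Unary.All.Properties as Allₚ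
open import Data.Nat as ℕ using (ℕ; zero; suc; z≤n; s≤s; _≤_; _<_; _∸_; _<ᵇ_; _%_)
import Data.Nat.Properties as ℕₚ
open import Data.Product using (Σ-syntax; _×_; _,_; proj₁; proj₂)
open import Data.Sum using (inj₁; inj₂)
open import Data.Unit using (tt)
open import Data.Vec using (Vec; []; _∷_)
import Data.Vec.Relation.Unary.All as VecAll
open VecAll using ([]; _∷_)
open import Function using (_∘_)
open import Relation.Binary.PropositionalEquality
open import Relation.Nullary using (¬_; Dec; yes; no)
open import Relation.Nullary.Decidable using (⌊_⌋)

module Sums where

  open import Data.Integer using (+_; _+_; _*_; _-_; -_)

  *-nonZero : ∀ {a b} → a ≢ 0ℤ → b ≢ 0ℤ → a * b ≢ 0ℤ
  *-nonZero {a} a≢0 b≢0 ab≡0 with ℤₚ.i*j≡0⇒i≡0∨j≡0 a ab≡0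
  ... | inj₁ a≡0 = a≢0 a≡0
  ... | inj₂ b≡0 = b≢0 b≡0

  *-cancelˡ-≡0 : ∀ {a b} → a ≢ 0ℤ → a * b ≡ 0ℤ → b ≡ 0ℤ
  *-cancelˡ-≡0 {a} a≢0 ab≡0 with ℤₚ.i*j≡0⇒i≡0∨j≡0 a ab≡0
  ... | inj₁ a≡0 = ⊥-elim (a≢0 a≡0)
  ... | inj₂ b≡0 = b≡0

  ∑ : ℕ → (ℕ → ℤ) → ℤ
  ∑ zero    f = 0ℤ
  ∑ (suc n) f = f 0 + ∑ n (f ∘ suc)

  ∑-cong : ∀ n {f g : ℕ → ℤ} → (∀ i → i < n → f i ≡ g i) → ∑ n f ≡ ∑ n g
  ∑-cong zero    f≗g = refl
  ∑-cong (suc n) f≗g = cong₂ _+_ (f≗g 0 (s≤s z≤n)) (∑-cong n (λ i i<n → f≗g (suc i) (s≤s i<n)))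

  ∑-zero : ∀ n → ∑ n (λ _ → 0ℤ) ≡ 0ℤ
  ∑-zero zero    = refl
  ∑-zero (suc n) = trans (ℤₚ.+-identityˡ _) (∑-zero n)

  ∑-+ : ∀ n (f g : ℕ → ℤ) → ∑ n (λ i → f i + g i) ≡ ∑ n f + ∑ n g
  ∑-+ zero    f g = refl
  ∑-+ (suc n) f g rewrite ∑-+ n (f ∘ suc) (g ∘ suc) = interchange (f 0) (g 0) _ _
    where
    interchange : ∀ a b c d → a + b + (c + d) ≡ a + c + (b + d)
    interchange = solve-∀

  ∑-*ˡ : ∀ n (a : ℤ) (f : ℕ → ℤ) → ∑ n (λ i → a * f i) ≡ a * ∑ n f
  ∑-*ˡ zero    a f = sym (ℤₚ.*-zeroʳ a)
  ∑-*ˡ (suc n) a f rewrite ∑-*ˡ n a (f ∘ suc) = sym (ℤₚ.*-distribˡ-+ a (f 0) _)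

  ∑-neg : ∀ n (f : ℕ → ℤ) → ∑ n (λ i → - f i) ≡ - ∑ n f
  ∑-neg zero    f = refl
  ∑-neg (suc n) f rewrite ∑-neg n (f ∘ suc) = sym (ℤₚ.neg-distrib-+ (f 0) _)

  ∑-sub : ∀ n (f g : ℕ → ℤ) → ∑ n (λ i → f i - g i) ≡ ∑ n f - ∑ n g
  ∑-sub n f g = trans (∑-+ n f (λ i → - g i)) (cong (λ z → ∑ n f + z) (∑-neg n g))

  ∑-const : ∀ n (a : ℤ) → ∑ n (λ _ → a) ≡ + n * a
  ∑-const zero    a = sym (ℤₚ.*-zeroˡ a)
  ∑-const (suc n) a = begin
    a + ∑ n (λ _ → a)     ≡⟨ cong (λ z → a + z) (∑-const n a) ⟩
    a + + n * a           ≡⟨ cong (_+ + n * a) (ℤₚ.*-identityˡ a) ⟨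
    1ℤ * a + + n * a      ≡⟨ ℤₚ.*-distribʳ-+ a 1ℤ (+ n) ⟨
    (1ℤ + + n) * a        ≡⟨ cong (_* a) (ℤₚ.pos-+ 1 n) ⟨
    + suc n * a           ∎
    where open ≡-Reasoning

  ∑-split : ∀ k s (f : ℕ → ℤ) → ∑ (k ℕ.+ s) f ≡ ∑ k f + ∑ s (λ i → f (k ℕ.+ i))
  ∑-split zero    s f = sym (ℤₚ.+-identityˡ _)
  ∑-split (suc k) s f rewrite ∑-split k s (f ∘ suc) = sym (ℤₚ.+-assoc (f 0) _ _)

  ∑-split-cong : ∀ k s {f g h : ℕ → ℤ} → (∀ r → r < k → h r ≡ f r) → (∀ i → h (k ℕ.+ i) ≡ g i) →
                 ∑ (k ℕ.+ s) h ≡ ∑ k f + ∑ s g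
  ∑-split-cong k s {h = h} lo hi =
    trans (∑-split k s h) (cong₂ _+_ (∑-cong k lo) (∑-cong s (λ i _ → hi i)))

  ∑-last : ∀ n (f : ℕ → ℤ) → ∑ (suc n) f ≡ ∑ n f + f n
  ∑-last n f = begin
    ∑ (suc n) f              ≡⟨ cong (λ l → ∑ l f) (ℕₚ.+-comm 1 n) ⟩
    ∑ (n ℕ.+ 1) f            ≡⟨ ∑-split n 1 f ⟩
    ∑ n f + (f (n ℕ.+ 0) + 0ℤ) ≡⟨ cong (λ z → ∑ n f + (f z + 0ℤ)) (ℕₚ.+-identityʳ n) ⟩
    ∑ n f + (f n + 0ℤ)       ≡⟨ cong (λ z → ∑ n f + z) (ℤₚ.+-identityʳ (f n)) ⟩
    ∑ n f + f n              ∎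
    where open ≡-Reasoning

  ∑-swap : ∀ n k (f : ℕ → ℕ → ℤ) → ∑ n (λ i → ∑ k (f i)) ≡ ∑ k (λ j → ∑ n (λ i → f i j))
  ∑-swap zero    k f = sym (∑-zero k)
  ∑-swap (suc n) k f rewrite ∑-swap n k (f ∘ suc) = sym (∑-+ k (f 0) _)

  ∑-single : ∀ n (f : ℕ → ℤ) t → t < n → (∀ i → i < n → i ≢ t → f i ≡ 0ℤ) → ∑ n f ≡ f t
  ∑-single (suc n) f zero    _         f≡0 = begin
    f 0 + ∑ n (f ∘ suc)   ≡⟨ cong (λ z → f 0 + z) (∑-cong n (λ i i<n → f≡0 (suc i) (s≤s i<n) (λ ()))) ⟩
    f 0 + ∑ n (λ _ → 0ℤ)  ≡⟨ cong (λ z → f 0 + z) (∑-zero n) ⟩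
    f 0 + 0ℤ              ≡⟨ ℤₚ.+-identityʳ _ ⟩
    f 0                   ∎
    where open ≡-Reasoning
  ∑-single (suc n) f (suc t) (s≤s t<n) f≡0 =
    trans (cong (_+ ∑ n (f ∘ suc)) (f≡0 0 (s≤s z≤n) (λ ())))
      (trans (ℤₚ.+-identityˡ _)
        (∑-single n (f ∘ suc) t t<n (λ i i<n i≢t → f≡0 (suc i) (s≤s i<n) (i≢t ∘ ℕₚ.suc-injective))))

  fromBool : Bool → ℤ
  fromBool b = if b then 1ℤ else 0ℤ

  δ : ℕ → ℕ → ℤ
  δ i j = fromBool ⌊ i ℕ.≟ j ⌋

  δ-refl : ∀ i → δ i i ≡ 1ℤ
  δ-refl i with i ℕ.≟ i
  ... | yes _  = refl
  ... | no i≢i = ⊥-elim (i≢i refl)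

  δ-≢ : ∀ {i j} → i ≢ j → δ i j ≡ 0ℤ
  δ-≢ {i} {j} i≢j with i ℕ.≟ j
  ... | yes i≡j = ⊥-elim (i≢j i≡j)
  ... | no _    = refl

  δ-cong-⇔ : ∀ {i j i′ j′} → (i ≡ j → i′ ≡ j′) → (i′ ≡ j′ → i ≡ j) → δ i j ≡ δ i′ j′
  δ-cong-⇔ {i} {j} {i′} {j′} to from with i ℕ.≟ j | i′ ℕ.≟ j′
  ... | yes _   | yes _    = refl
  ... | yes i≡j | no i′≢j′ = ⊥-elim (i′≢j′ (to i≡j))
  ... | no i≢j  | yes i′≡j′ = ⊥-elim (i≢j (from i′≡j′))
  ... | no _    | no _     = refl

  δ-sym : ∀ i j → δ i j ≡ δ j i
  δ-sym i j = δ-cong-⇔ sym sym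

  ∑-δ : ∀ n a (f : ℕ → ℤ) → a < n → ∑ n (λ i → δ i a * f i) ≡ f a
  ∑-δ n a f a<n = begin
    ∑ n (λ i → δ i a * f i)  ≡⟨ ∑-single n _ a a<n (λ i _ i≢a → trans (cong (_* f i) (δ-≢ i≢a)) (ℤₚ.*-zeroˡ (f i))) ⟩
    δ a a * f a              ≡⟨ cong (_* f a) (δ-refl a) ⟩
    1ℤ * f a                 ≡⟨ ℤₚ.*-identityˡ (f a) ⟩
    f a                      ∎
    where open ≡-Reasoning

  dot : ℕ → (ℕ → ℤ) → (ℕ → ℤ) → ℤ
  dot n a x = ∑ n (λ i → a i * x i)

  ∑ℕ : ℕ → (ℕ → ℕ) → ℕ
  ∑ℕ zero    f = 0
  ∑ℕ (suc n) f = f 0 ℕ.+ ∑ℕ n (f ∘ suc)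

  ∑-pos : ∀ n (f : ℕ → ℕ) → ∑ n (+_ ∘ f) ≡ + ∑ℕ n f
  ∑-pos zero    f = refl
  ∑-pos (suc n) f = trans (cong (λ z → + f 0 + z) (∑-pos n (f ∘ suc))) (sym (ℤₚ.pos-+ (f 0) _))

  ∑ℕ≡0⇒≡0 : ∀ n (f : ℕ → ℕ) → ∑ℕ n f ≡ 0 → ∀ i → i < n → f i ≡ 0
  ∑ℕ≡0⇒≡0 (suc n) f sum≡0 zero    _         = ℕₚ.m+n≡0⇒m≡0 (f 0) sum≡0
  ∑ℕ≡0⇒≡0 (suc n) f sum≡0 (suc i) (s≤s i<n) = ∑ℕ≡0⇒≡0 n (f ∘ suc) (ℕₚ.m+n≡0⇒n≡0 (f 0) sum≡0) i i<n

  ∑ℕ-lowerBound : ∀ n (f : ℕ → ℕ) a → (∀ i → i < n → a ≤ f i) → n ℕ.* a ≤ ∑ℕ n f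
  ∑ℕ-lowerBound zero    f a _   = z≤n
  ∑ℕ-lowerBound (suc n) f a a≤f =
    ℕₚ.+-mono-≤ (a≤f 0 (s≤s z≤n)) (∑ℕ-lowerBound n (f ∘ suc) a (λ i i<n → a≤f (suc i) (s≤s i<n)))

module LinearAlgebra where

  open import Data.Integer using (_+_; _*_; _-_; -_)
  open import Data.List.Relation.Unary.Any as Any using (Any)
  import Data.List.Relation.Unary.Any.Properties as Anyₚ
  open Sums

  NonZeroBelow : ℕ → (ℕ → ℤ) → Set
  NonZeroBelow N x = Σ[ c ∈ ℕ ] c < N × x c ≢ 0ℤ

  -- One step of Gaussian elimination, with pivot row p (p 0 ≢ 0).
  reduce : (p a : ℕ → ℤ) → ℕ → ℤ
  reduce p a i = p 0 * a (suc i) - a 0 * p (suc i)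

  lift : ℕ → (p x : ℕ → ℤ) → ℕ → ℤ
  lift N p x zero    = - ∑ N (λ i → p (suc i) * x i)
  lift N p x (suc i) = p 0 * x i

  dot-lift : ∀ N (p a x : ℕ → ℤ) → dot (suc N) a (lift N p x) ≡ dot N (reduce p a) x
  dot-lift N p a x = begin
    a 0 * (- Dp) + ∑ N (λ i → a (suc i) * (p 0 * x i))
      ≡⟨ cong (λ z → a 0 * (- Dp) + z) (trans (∑-cong N (λ i _ → swap (a (suc i)) (p 0) (x i))) (∑-*ˡ N (p 0) _)) ⟩
    a 0 * (- Dp) + p 0 * Da
      ≡⟨ regroup (a 0) Dp (p 0) Da ⟩
    p 0 * Da - a 0 * Dp
      ≡⟨ cong₂ _-_ (∑-*ˡ N (p 0) _) (∑-*ˡ N (a 0) _) ⟨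
    ∑ N (λ i → p 0 * (a (suc i) * x i)) - ∑ N (λ i → a 0 * (p (suc i) * x i))
      ≡⟨ ∑-sub N _ _ ⟨
    ∑ N (λ i → p 0 * (a (suc i) * x i) - a 0 * (p (suc i) * x i))
      ≡⟨ ∑-cong N (λ i _ → distrib (p 0) (a (suc i)) (a 0) (p (suc i)) (x i)) ⟨
    dot N (reduce p a) x ∎
    where
    open ≡-Reasoning
    Dp = ∑ N (λ i → p (suc i) * x i)
    Da = ∑ N (λ i → a (suc i) * x i)
    swap : ∀ u v w → u * (v * w) ≡ v * (u * w)
    swap = solve-∀
    regroup : ∀ a d q e → a * (- d) + q * e ≡ q * e - a * d
    regroup = solve-∀
    distrib : ∀ q u a v w → (q * u - a * v) * w ≡ q * (u * w) - a * (v * w)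
    distrib = solve-∀

  dot-reduce-self : ∀ N (p x : ℕ → ℤ) → dot N (reduce p p) x ≡ 0ℤ
  dot-reduce-self N p x = trans (∑-cong N (λ i _ → vanish (p 0) (p (suc i)) (x i))) (∑-zero N)
    where
    vanish : ∀ a b c → (a * b - a * b) * c ≡ 0ℤ
    vanish = solve-∀

  Orthogonal : ℕ → List (ℕ → ℤ) → (ℕ → ℤ) → Set
  Orthogonal N rows x = All (λ a → dot N a x ≡ 0ℤ) rows

  nontrivial-solution : ∀ N (rows : List (ℕ → ℤ)) → length rows < N →
                        Σ[ x ∈ (ℕ → ℤ) ] NonZeroBelow N x × Orthogonal N rows x
  nontrivial-solution zero    rows ()
  nontrivial-solution (suc N) rows len<
    with All.all? (λ a → a 0 ℤ.≟ 0ℤ) rows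
  ... | yes firsts≡0 = e₀ , (0 , s≤s z≤n , λ ()) , All.map (λ {a} → dot-e₀ {a}) firsts≡0
    where
    e₀ : ℕ → ℤ
    e₀ i = δ i 0
    dot-e₀ : ∀ {a} → a 0 ≡ 0ℤ → dot (suc N) a e₀ ≡ 0ℤ
    dot-e₀ {a} a₀≡0 = cong₂ _+_ (cong (_* 1ℤ) a₀≡0) (trans (∑-cong N (λ i _ → ℤₚ.*-zeroʳ (a (suc i)))) (∑-zero N))
  ... | no ¬firsts≡0 = lift N p x , (suc c , s≤s c<N , *-nonZero p₀≢0 xc≢0) , solves
    where
    pivot : Any (λ a → a 0 ≢ 0ℤ) rows
    pivot = Allₚ.¬All⇒Any¬ (λ a → a 0 ℤ.≟ 0ℤ) rows ¬firsts≡0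
    p = Any.lookup pivot
    p₀≢0 : p 0 ≢ 0ℤ
    p₀≢0 = Anyₚ.lookup-result pivot
    rest = rows Any.─ pivot
    shorter : length (map (reduce p) rest) < N
    shorter = begin-strict
      length (map (reduce p) rest) ≡⟨ Listₚ.length-map (reduce p) rest ⟩
      length rest                  <⟨ ℕₚ.n<1+n _ ⟩
      suc (length rest)            ≡⟨ Listₚ.length-removeAt′ rows (Any.index pivot) ⟨
      length rows                  ≤⟨ ℕₚ.≤-pred len< ⟩
      N                            ∎
      where open ℕₚ.≤-Reasoning
    solution = nontrivial-solution N (map (reduce p) rest) shorter
    x = proj₁ solution
    c = proj₁ (proj₁ (proj₂ solution))
    c<N = proj₁ (proj₂ (proj₁ (proj₂ solution)))
    xc≢0 = proj₂ (proj₂ (proj₁ (proj₂ solution)))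
    solves : Orthogonal (suc N) rows (lift N p x)
    solves = Allₚ.─⁻ pivot (trans (dot-lift N p p x) (dot-reduce-self N p x))
               (All.map (λ {a} ⊥a → trans (dot-lift N p a x) ⊥a) (Allₚ.map⁻ (proj₂ (proj₂ solution))))

module BlockIndexing where

  open import Data.Nat using (_+_)

  <ᵇ-true : ∀ {m n} → m < n → (m <ᵇ n) ≡ true
  <ᵇ-true {m} {n} m<n with m <ᵇ n | ℕₚ.<⇒<ᵇ m<n
  ... | true | _ = refl

  <ᵇ-false : ∀ {m n} → ¬ m < n → (m <ᵇ n) ≡ false
  <ᵇ-false {m} {n} m≮n with m <ᵇ n | ℕₚ.<ᵇ⇒< m n
  ... | false | _       = refl
  ... | true  | from-T = ⊥-elim (m≮n (from-T tt))

  m+n≮m : ∀ m n → ¬ m + n < m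
  m+n≮m m n m+n<m = ℕₚ.<-irrefl refl (ℕₚ.<-≤-trans m+n<m (ℕₚ.m≤m+n m n))

  m+[n∸m]≡n′ : ∀ {m n} → ¬ n < m → m + (n ∸ m) ≡ n
  m+[n∸m]≡n′ n≮m = ℕₚ.m+[n∸m]≡n (ℕₚ.≮⇒≥ n≮m)

  ∸-<-+ : ∀ {k s a} → a < k + s → ¬ a < k → a ∸ k < s
  ∸-<-+ {k} {s} a<k+s a≮k = ℕₚ.+-cancelˡ-< k _ _ (subst (_< k + s) (sym (m+[n∸m]≡n′ a≮k)) a<k+s)

  cycSuc : ℕ → ℕ → ℕ
  cycSuc k r = if ⌊ suc r ℕ.≟ k ⌋ then 0 else suc r

  cycPred : ℕ → ℕ → ℕ
  cycPred k zero    = k ∸ 1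
  cycPred k (suc c) = c

  cycSuc-last : ∀ {k r} → suc r ≡ k → cycSuc k r ≡ 0
  cycSuc-last {k} {r} sr≡k with suc r ℕ.≟ k
  ... | yes _    = refl
  ... | no sr≢k = ⊥-elim (sr≢k sr≡k)

  cycSuc-notLast : ∀ {k r} → suc r ≢ k → cycSuc k r ≡ suc r
  cycSuc-notLast {k} {r} sr≢k with suc r ℕ.≟ k
  ... | yes sr≡k = ⊥-elim (sr≢k sr≡k)
  ... | no _      = refl

  cycSuc-< : ∀ {k r} → r < k → cycSuc k r < k
  cycSuc-< {k} {r} r<k with suc r ℕ.≟ k
  ... | yes _    = ℕₚ.≤-trans (s≤s z≤n) r<k
  ... | no sr≢k = ℕₚ.≤∧≢⇒< r<k sr≢k

  cycSuc-≢ : ∀ {k r} → 2 ≤ k → cycSuc k r ≢ r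
  cycSuc-≢ {k} {r} 2≤k with suc r ℕ.≟ k
  ... | no _     = ℕₚ.1+n≢n
  ... | yes sr≡k = λ 0≡r →
    ℕₚ.<-irrefl refl (ℕₚ.≤-trans 2≤k (ℕₚ.≤-reflexive (trans (sym sr≡k) (cong suc (sym 0≡r)))))

  cycPred-< : ∀ {k c} → c < k → cycPred k c < k
  cycPred-< {suc k} {zero}  _      = ℕₚ.n<1+n k
  cycPred-< {k}     {suc c} sc<k = ℕₚ.<-trans (ℕₚ.n<1+n c) sc<k

  cycPred-cycSuc : ∀ k r → cycPred k (cycSuc k r) ≡ r
  cycPred-cycSuc k r with suc r ℕ.≟ k
  ... | yes sr≡k = cong (_∸ 1) (sym sr≡k)
  ... | no _      = refl

  cycSuc-cycPred : ∀ {k c} → c < k → cycSuc k (cycPred k c) ≡ c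
  cycSuc-cycPred {suc k} {zero}  _     = cycSuc-last refl
  cycSuc-cycPred {k}     {suc c} sc<k = cycSuc-notLast (λ sc≡k → ℕₚ.<-irrefl sc≡k sc<k)

  blockSuc : ∀ {m} → Vec ℕ m → ℕ → ℕ
  blockSuc []       r = r
  blockSuc (k ∷ ks) r = if r <ᵇ k then cycSuc k r else k + blockSuc ks (r ∸ k)

  blockPred : ∀ {m} → Vec ℕ m → ℕ → ℕ
  blockPred []       c = c
  blockPred (k ∷ ks) c = if c <ᵇ k then cycPred k c else k + blockPred ks (c ∸ k)

  blockSuc-shift : ∀ k {m} (ks : Vec ℕ m) i → blockSuc (k ∷ ks) (k + i) ≡ k + blockSuc ks i
  blockSuc-shift k ks i rewrite <ᵇ-false (m+n≮m k i) | ℕₚ.m+n∸m≡n k i = refl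

  blockPred-inner : ∀ {k m} (ks : Vec ℕ m) {c} → c < k → blockPred (k ∷ ks) c ≡ cycPred k c
  blockPred-inner ks c<k rewrite <ᵇ-true c<k = refl

  blockPred-outer : ∀ {k m} (ks : Vec ℕ m) {c} → ¬ c < k → blockPred (k ∷ ks) c ≡ k + blockPred ks (c ∸ k)
  blockPred-outer ks c≮k rewrite <ᵇ-false c≮k = refl

  blockSuc-< : ∀ {m} (ns : Vec ℕ m) {r} → r < sumV ns → blockSuc ns r < sumV ns
  blockSuc-< (k ∷ ks) {r} r<n with r ℕ.<? k
  ... | yes r<k rewrite <ᵇ-true r<k = ℕₚ.<-≤-trans (cycSuc-< r<k) (ℕₚ.m≤m+n k (sumV ks))
  ... | no r≮k rewrite <ᵇ-false r≮k = ℕₚ.+-monoʳ-< k (blockSuc-< ks (∸-<-+ r<n r≮k))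

  blockPred-< : ∀ {m} (ns : Vec ℕ m) {c} → c < sumV ns → blockPred ns c < sumV ns
  blockPred-< (k ∷ ks) {c} c<n with c ℕ.<? k
  ... | yes c<k rewrite <ᵇ-true c<k = ℕₚ.<-≤-trans (cycPred-< c<k) (ℕₚ.m≤m+n k (sumV ks))
  ... | no c≮k rewrite <ᵇ-false c≮k = ℕₚ.+-monoʳ-< k (blockPred-< ks (∸-<-+ c<n c≮k))

  blockPred-blockSuc : ∀ {m} (ns : Vec ℕ m) {r} → r < sumV ns → blockPred ns (blockSuc ns r) ≡ r
  blockPred-blockSuc (k ∷ ks) {r} r<n with r ℕ.<? k
  ... | yes r<k rewrite <ᵇ-true r<k | <ᵇ-true (cycSuc-< r<k) = cycPred-cycSuc k r
  ... | no r≮k rewrite <ᵇ-false r≮k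
    | <ᵇ-false (m+n≮m k (blockSuc ks (r ∸ k))) | ℕₚ.m+n∸m≡n k (blockSuc ks (r ∸ k)) =
    trans (cong (k +_) (blockPred-blockSuc ks (∸-<-+ r<n r≮k))) (m+[n∸m]≡n′ r≮k)

  blockSuc-blockPred : ∀ {m} (ns : Vec ℕ m) {c} → c < sumV ns → blockSuc ns (blockPred ns c) ≡ c
  blockSuc-blockPred (k ∷ ks) {c} c<n with c ℕ.<? k
  ... | yes c<k rewrite <ᵇ-true c<k | <ᵇ-true (cycPred-< c<k) = cycSuc-cycPred c<k
  ... | no c≮k rewrite <ᵇ-false c≮k
    | <ᵇ-false (m+n≮m k (blockPred ks (c ∸ k))) | ℕₚ.m+n∸m≡n k (blockPred ks (c ∸ k)) =
    trans (cong (k +_) (blockSuc-blockPred ks (∸-<-+ c<n c≮k))) (m+[n∸m]≡n′ c≮k)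

  blockSuc-≢ : ∀ {m} (ns : Vec ℕ m) → VecAll.All (2 ≤_) ns → ∀ {t} → t < sumV ns → blockSuc ns t ≢ t
  blockSuc-≢ (k ∷ ks) (2≤k ∷ ks≥2) {t} t<n with t ℕ.<? k
  ... | yes t<k rewrite <ᵇ-true t<k = cycSuc-≢ 2≤k
  ... | no t≮k rewrite <ᵇ-false t≮k = λ eq →
    blockSuc-≢ ks ks≥2 (∸-<-+ t<n t≮k) (ℕₚ.+-cancelˡ-≡ k _ _ (trans eq (sym (m+[n∸m]≡n′ t≮k))))

  offset : ∀ {m} → Vec ℕ m → ℕ → ℕ
  offset []       r = r
  offset (k ∷ ks) r = if r <ᵇ k then r else offset ks (r ∸ k)

  blockIndex : ∀ {m} → Vec ℕ m → ℕ → ℕ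
  blockIndex []       r = 0
  blockIndex (k ∷ ks) r = if r <ᵇ k then 0 else suc (blockIndex ks (r ∸ k))

  offset-shift : ∀ k {m} (ks : Vec ℕ m) i → offset (k ∷ ks) (k + i) ≡ offset ks i
  offset-shift k ks i rewrite <ᵇ-false (m+n≮m k i) | ℕₚ.m+n∸m≡n k i = refl

  blockIndex-blockPred : ∀ {m} (ns : Vec ℕ m) {c} → c < sumV ns → blockIndex ns (blockPred ns c) ≡ blockIndex ns c
  blockIndex-blockPred (k ∷ ks) {c} c<n with c ℕ.<? k
  ... | yes c<k rewrite <ᵇ-true c<k | <ᵇ-true (cycPred-< c<k) = refl
  ... | no c≮k rewrite <ᵇ-false c≮k
    | <ᵇ-false (m+n≮m k (blockPred ks (c ∸ k))) | ℕₚ.m+n∸m≡n k (blockPred ks (c ∸ k)) =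
    cong suc (blockIndex-blockPred ks (∸-<-+ c<n c≮k))

  blockIndex-offset-injective : ∀ {m} (ns : Vec ℕ m) r t →
    blockIndex ns r ≡ blockIndex ns t → offset ns r ≡ offset ns t → r ≡ t
  blockIndex-offset-injective []       r t _ same-offset = same-offset
  blockIndex-offset-injective (k ∷ ks) r t same-block same-offset with r ℕ.<? k | t ℕ.<? k
  ... | yes r<k | yes t<k rewrite <ᵇ-true r<k | <ᵇ-true t<k = same-offset
  ... | yes r<k | no t≮k rewrite <ᵇ-true r<k | <ᵇ-false t≮k = ⊥-elim (ℕₚ.0≢1+n same-block)
  ... | no r≮k | yes t<k rewrite <ᵇ-false r≮k | <ᵇ-true t<k = ⊥-elim (ℕₚ.0≢1+n (sym same-block))
  ... | no r≮k | no t≮k rewrite <ᵇ-false r≮k | <ᵇ-false t≮k = begin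
    r                  ≡⟨ m+[n∸m]≡n′ r≮k ⟨
    k + (r ∸ k)        ≡⟨ cong (k +_) (blockIndex-offset-injective ks (r ∸ k) (t ∸ k) (ℕₚ.suc-injective same-block) same-offset) ⟩
    k + (t ∸ k)        ≡⟨ m+[n∸m]≡n′ t≮k ⟩
    t                  ∎
    where open ≡-Reasoning

  offset-blockPred≡0 : ∀ {m} (ns : Vec ℕ m) → VecAll.All (2 ≤_) ns → ∀ {c} → c < sumV ns →
                       offset ns (blockPred ns c) ≡ 0 → offset ns c ≡ 1
  offset-blockPred≡0 (k ∷ ks) (2≤k ∷ ks≥2) {c} c<n with c ℕ.<? k
  ... | yes c<k rewrite <ᵇ-true c<k | <ᵇ-true (cycPred-< c<k) = inner c
    where
    inner : ∀ c → cycPred k c ≡ 0 → c ≡ 1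
    inner zero    k∸1≡0 = ⊥-elim (ℕₚ.<⇒≱ (s≤s (s≤s z≤n))
                            (subst (2 ≤_) (trans (sym (ℕₚ.m∸n+n≡m (ℕₚ.≤-trans (s≤s z≤n) 2≤k))) (cong (_+ 1) k∸1≡0)) 2≤k))
    inner (suc c) c≡0   = cong suc c≡0
  ... | no c≮k rewrite <ᵇ-false c≮k
    | <ᵇ-false (m+n≮m k (blockPred ks (c ∸ k))) | ℕₚ.m+n∸m≡n k (blockPred ks (c ∸ k)) =
    offset-blockPred≡0 ks ks≥2 (∸-<-+ c<n c≮k)

  Even : ℕ → Set
  Even k = Σ[ j ∈ ℕ ] k ≡ j + j

  isEven : ℕ → Bool
  isEven zero    = true
  isEven (suc n) = not (isEven n)

  isEven-double : ∀ j → isEven (j + j) ≡ true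
  isEven-double zero    = refl
  isEven-double (suc j) rewrite ℕₚ.+-suc j j | isEven-double j = refl

  isEven-cycPred : ∀ {k} c → Even k → 2 ≤ k → isEven (cycPred k c) ≡ not (isEven c)
  isEven-cycPred {.(suc j + suc j)} zero (suc j , refl) _ rewrite ℕₚ.+-suc j j | isEven-double j = refl
  isEven-cycPred (suc c) _ _ with isEven c
  ... | true  = refl
  ... | false = refl

  isEven-offset-blockPred : ∀ {m} (ns : Vec ℕ m) → VecAll.All (2 ≤_) ns → VecAll.All Even ns → ∀ {c} → c < sumV ns →
                            isEven (offset ns (blockPred ns c)) ≡ not (isEven (offset ns c))
  isEven-offset-blockPred (k ∷ ks) (2≤k ∷ ks≥2) (k-even ∷ ks-even) {c} c<n with c ℕ.<? k
  ... | yes c<k rewrite <ᵇ-true c<k | <ᵇ-true (cycPred-< c<k) = isEven-cycPred c k-even 2≤k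
  ... | no c≮k rewrite <ᵇ-false c≮k
    | <ᵇ-false (m+n≮m k (blockPred ks (c ∸ k))) | ℕₚ.m+n∸m≡n k (blockPred ks (c ∸ k)) =
    isEven-offset-blockPred ks ks≥2 ks-even (∸-<-+ c<n c≮k)

module ComplementMatrix where

  open import Data.Integer using (_+_; _*_; _-_)
  import Data.Nat.DivMod as DivMod
  open Sums
  open BlockIndexing

  -- Dentry K (K ∸ 2) r c is 1 exactly when the cyclic difference c - r is 0 or 1.
  circDiff : ℕ → ℕ → ℕ → ℕ
  circDiff q r c = (c ℕ.+ suc q ∸ r) % suc q

  circDiff-≥ : ∀ {q r c} → r ≤ c → c < suc q → circDiff q r c ≡ c ∸ r
  circDiff-≥ {q} {r} {c} r≤c c<K = begin
    (c ℕ.+ suc q ∸ r) % suc q   ≡⟨ cong (_% suc q) (ℕₚ.+-∸-comm (suc q) r≤c) ⟩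
    (c ∸ r ℕ.+ suc q) % suc q   ≡⟨ DivMod.[m+n]%n≡m%n (c ∸ r) (suc q) ⟩
    (c ∸ r) % suc q             ≡⟨ DivMod.m<n⇒m%n≡m (ℕₚ.≤-<-trans (ℕₚ.m∸n≤m c r) c<K) ⟩
    c ∸ r                       ∎
    where open ≡-Reasoning

  circDiff-< : ∀ {q r c} → r < suc q → c < r → circDiff q r c ≡ c ℕ.+ (suc q ∸ r)
  circDiff-< {q} {r} {c} r<K c<r = trans (cong (_% suc q) (ℕₚ.+-∸-assoc c (ℕₚ.<⇒≤ r<K))) (DivMod.m<n⇒m%n≡m wraps)
    where
    wraps : c ℕ.+ (suc q ∸ r) < suc q
    wraps = subst (c ℕ.+ (suc q ∸ r) <_) (trans (ℕₚ.+-comm r _) (ℕₚ.m∸n+n≡m (ℕₚ.<⇒≤ r<K)))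
                  (ℕₚ.+-monoˡ-< (suc q ∸ r) c<r)

  circDiff≡0⇒≡ : ∀ {q r c} → r < suc q → c < suc q → circDiff q r c ≡ 0 → c ≡ r
  circDiff≡0⇒≡ {q} {r} {c} r<K c<K diff≡0 with ℕₚ.≤-<-connex r c
  ... | inj₁ r≤c = sym (ℕₚ.≤-antisym r≤c (ℕₚ.m∸n≡0⇒m≤n (trans (sym (circDiff-≥ r≤c c<K)) diff≡0)))
  ... | inj₂ c<r = ⊥-elim (ℕₚ.<-irrefl (sym (trans (sym (circDiff-< r<K c<r)) diff≡0))
                     (ℕₚ.≤-trans (ℕₚ.m<n⇒0<n∸m r<K) (ℕₚ.m≤n+m (suc q ∸ r) c)))

  circDiff-refl : ∀ {q r} → r < suc q → circDiff q r r ≡ 0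
  circDiff-refl {r = r} r<K = trans (circDiff-≥ ℕₚ.≤-refl r<K) (ℕₚ.n∸n≡0 r)

  circDiff≡1⇒≡cycSuc : ∀ {q r c} → r < suc q → c < suc q → circDiff q r c ≡ 1 → c ≡ cycSuc (suc q) r
  circDiff≡1⇒≡cycSuc {q} {r} {c} r<K c<K diff≡1 with ℕₚ.≤-<-connex r c
  ... | inj₁ r≤c = trans c≡1+r (sym (cycSuc-notLast (λ 1+r≡K → ℕₚ.<-irrefl (trans c≡1+r 1+r≡K) c<K)))
    where
    c≡1+r : c ≡ suc r
    c≡1+r = trans (sym (ℕₚ.m∸n+n≡m r≤c)) (cong (ℕ._+ r) (trans (sym (circDiff-≥ r≤c c<K)) diff≡1))
  ... | inj₂ c<r = trans c≡0 (sym (cycSuc-last 1+r≡K))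
    where
    wrapped : c ℕ.+ (suc q ∸ r) ≡ 1
    wrapped = trans (sym (circDiff-< r<K c<r)) diff≡1
    gap : suc q ∸ r ≡ suc (q ∸ r)
    gap = ℕₚ.+-∸-assoc 1 (ℕₚ.≤-pred r<K)
    c≡0 : c ≡ 0
    c≡0 = ℕₚ.m+n≡0⇒m≡0 c (ℕₚ.suc-injective (trans (sym (ℕₚ.+-suc c _)) (trans (cong (c ℕ.+_) (sym gap)) wrapped)))
    1+r≡K : suc r ≡ suc q
    1+r≡K = trans (cong (ℕ._+ r) (sym (trans (cong (ℕ._+ (suc q ∸ r)) (sym c≡0)) wrapped))) (ℕₚ.m∸n+n≡m (ℕₚ.<⇒≤ r<K))

  circDiff-cycSuc : ∀ {q r} → r < suc (suc q) → circDiff (suc q) r (cycSuc (suc (suc q)) r) ≡ 1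
  circDiff-cycSuc {q} {r} r<K with suc r ℕ.≟ suc (suc q)
  ... | yes 1+r≡K = trans (cong (_% suc (suc q)) K∸r≡1) (DivMod.m<n⇒m%n≡m {n = suc (suc q)} (s≤s (s≤s z≤n)))
    where
    K∸r≡1 : suc (suc q) ∸ r ≡ 1
    K∸r≡1 = trans (cong (_∸ r) (sym 1+r≡K)) (ℕₚ.m+n∸n≡m 1 r)
  ... | no 1+r≢K = trans (circDiff-≥ (ℕₚ.n≤1+n r) (ℕₚ.≤∧≢⇒< r<K 1+r≢K)) (ℕₚ.m+n∸n≡m 1 r)

  Dentry-twoOnes : ∀ {q r c} → r < suc (suc q) → c < suc (suc q) →
                   fromBool (Dentry (suc (suc q)) q r c) ≡ δ c r + δ c (cycSuc (suc (suc q)) r)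
  Dentry-twoOnes {q} {r} {c} r<K c<K rewrite ℕₚ.m+n∸n≡m 2 q with circDiff (suc q) r c in diff
  ... | zero = sym (begin
    δ c r + δ c (cycSuc K r)   ≡⟨ cong (λ x → δ x r + δ x (cycSuc K r)) c≡r ⟩
    δ r r + δ r (cycSuc K r)   ≡⟨ cong₂ _+_ (δ-refl r) (δ-≢ (cycSuc-≢ (s≤s (s≤s z≤n)) ∘ sym)) ⟩
    1ℤ                         ∎)
    where
    open ≡-Reasoning
    K = suc (suc q)
    c≡r = circDiff≡0⇒≡ r<K c<K diff
  ... | suc zero = sym (begin
    δ c r + δ c (cycSuc K r)   ≡⟨ cong₂ _+_ (δ-≢ (λ c≡r → ℕₚ.0≢1+n (trans (sym (refl-diff c≡r)) diff)))
                                             (cong (δ c) (sym (circDiff≡1⇒≡cycSuc r<K c<K diff))) ⟩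
    0ℤ + δ c c                 ≡⟨ ℤₚ.+-identityˡ (δ c c) ⟩
    δ c c                      ≡⟨ δ-refl c ⟩
    1ℤ                         ∎)
    where
    open ≡-Reasoning
    K = suc (suc q)
    refl-diff : c ≡ r → circDiff (suc q) r c ≡ 0
    refl-diff refl = circDiff-refl r<K
  ... | suc (suc _) = sym (cong₂ _+_
    (δ-≢ {c} {r} (λ { refl → ℕₚ.0≢1+n (trans (sym (circDiff-refl r<K)) diff) }))
    (δ-≢ {c} {cycSuc (suc (suc q)) r} (λ { refl → ℕₚ.0≢1+n (ℕₚ.suc-injective (trans (sym (circDiff-cycSuc r<K)) diff)) })))

  blockEntry-δ : ∀ {m} (ns : Vec ℕ m) → VecAll.All (2 ≤_) ns → ∀ {r c} → r < sumV ns → c < sumV ns →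
                 fromBool (blockEntry ns r c) ≡ δ c r + δ c (blockSuc ns r)
  blockEntry-δ (0 ∷ ks)             (() ∷ _)
  blockEntry-δ (1 ∷ ks)             (s≤s () ∷ _)
  blockEntry-δ (suc (suc q) ∷ ks) (_ ∷ ks≥2) {r} {c} r<n c<n with r ℕ.<? suc (suc q) | c ℕ.<? suc (suc q)
  ... | yes r<k | yes c<k rewrite <ᵇ-true r<k | <ᵇ-true c<k = Dentry-twoOnes r<k c<k
  ... | yes r<k | no c≮k rewrite <ᵇ-true r<k | <ᵇ-false c≮k =
    sym (cong₂ _+_ (δ-≢ {c} {r} (λ { refl → c≮k r<k }))
                   (δ-≢ {c} {cycSuc _ r} (λ { refl → c≮k (cycSuc-< r<k) })))
  ... | no r≮k | yes c<k rewrite <ᵇ-false r≮k | <ᵇ-true c<k =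
    sym (cong₂ _+_ (δ-≢ {c} {r} (λ { refl → r≮k c<k }))
                   (δ-≢ {c} {suc (suc q) ℕ.+ _} (λ { refl → m+n≮m (suc (suc q)) _ c<k })))
  ... | no r≮k | no c≮k rewrite <ᵇ-false r≮k | <ᵇ-false c≮k = begin
    fromBool (blockEntry ks (r ∸ k) (c ∸ k))
      ≡⟨ blockEntry-δ ks ks≥2 (∸-<-+ r<n r≮k) (∸-<-+ c<n c≮k) ⟩
    δ (c ∸ k) (r ∸ k) + δ (c ∸ k) (blockSuc ks (r ∸ k))
      ≡⟨ cong₂ _+_ (δ-cong-⇔ (λ eq → trans (sym (m+[n∸m]≡n′ c≮k)) (trans (cong (k ℕ.+_) eq) (m+[n∸m]≡n′ r≮k)))
                             (cong (_∸ k)))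
                   (δ-cong-⇔ (λ eq → trans (sym (m+[n∸m]≡n′ c≮k)) (cong (k ℕ.+_) eq))
                             (λ eq → trans (cong (_∸ k) eq) (ℕₚ.m+n∸m≡n k _))) ⟩
    δ c r + δ c (k ℕ.+ blockSuc ks (r ∸ k)) ∎
    where
    open ≡-Reasoning
    k = suc (suc q)

  δ-blockSuc : ∀ {m} (ns : Vec ℕ m) {r c} → r < sumV ns → c < sumV ns → δ c (blockSuc ns r) ≡ δ r (blockPred ns c)
  δ-blockSuc ns r<n c<n = δ-cong-⇔
    (λ c≡ → trans (sym (blockPred-blockSuc ns r<n)) (cong (blockPred ns) (sym c≡)))
    (λ r≡ → trans (sym (blockSuc-blockPred ns c<n)) (cong (blockSuc ns) (sym r≡)))

  ∑-δ-blockSuc : ∀ {m} (ns : Vec ℕ m) (h : ℕ → ℤ) {c} → c < sumV ns →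
                 ∑ (sumV ns) (λ r → δ c (blockSuc ns r) * h r) ≡ h (blockPred ns c)
  ∑-δ-blockSuc ns h c<n = trans (∑-cong (sumV ns) (λ r r<n → cong (_* h r) (δ-blockSuc ns r<n c<n)))
                                (∑-δ (sumV ns) _ h (blockPred-< ns c<n))

  ∑-blockSuc : ∀ {m} (ns : Vec ℕ m) (f : ℕ → ℤ) → ∑ (sumV ns) (f ∘ blockSuc ns) ≡ ∑ (sumV ns) f
  ∑-blockSuc ns f = begin
    ∑ n (f ∘ blockSuc ns)                            ≡⟨ ∑-cong n (λ r r<n → sym (∑-δ n _ f (blockSuc-< ns r<n))) ⟩
    ∑ n (λ r → ∑ n (λ c → δ c (blockSuc ns r) * f c)) ≡⟨ ∑-swap n n _ ⟩
    ∑ n (λ c → ∑ n (λ r → δ c (blockSuc ns r) * f c)) ≡⟨ ∑-cong n (λ c c<n → ∑-δ-blockSuc ns (λ _ → f c) c<n) ⟩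
    ∑ n f                                             ∎
    where
    open ≡-Reasoning
    n = sumV ns

  Mℤ : ∀ {m} → Vec ℕ m → ℕ → ℕ → ℤ
  Mℤ ns r c = fromBool (not (blockEntry ns r c))

  fromBool-not : ∀ b → fromBool (not b) ≡ 1ℤ - fromBool b
  fromBool-not true  = refl
  fromBool-not false = refl

  ∑-twoPoint-complement : ∀ n (e x : ℕ → ℤ) {a b} → a < n → b < n →
    (∀ i → i < n → e i ≡ 1ℤ - (δ i a + δ i b)) → ∑ n (λ i → e i * x i) ≡ ∑ n x - (x a + x b)
  ∑-twoPoint-complement n e x {a} {b} a<n b<n e≡ = begin
    ∑ n (λ i → e i * x i)                                   ≡⟨ ∑-cong n (λ i i<n → trans (cong (_* x i) (e≡ i i<n)) (expand (δ i a) (δ i b) (x i))) ⟩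
    ∑ n (λ i → x i - (δ i a * x i + δ i b * x i))           ≡⟨ ∑-sub n x _ ⟩
    ∑ n x - ∑ n (λ i → δ i a * x i + δ i b * x i)           ≡⟨ cong (λ z → ∑ n x - z) (∑-+ n _ _) ⟩
    ∑ n x - (∑ n (λ i → δ i a * x i) + ∑ n (λ i → δ i b * x i)) ≡⟨ cong (λ z → ∑ n x - z) (cong₂ _+_ (∑-δ n a x a<n) (∑-δ n b x b<n)) ⟩
    ∑ n x - (x a + x b)                                     ∎
    where
    open ≡-Reasoning
    expand : ∀ u v y → (1ℤ - (u + v)) * y ≡ y - (u * y + v * y)
    expand = solve-∀

  Mℤ-row : ∀ {m} (ns : Vec ℕ m) → VecAll.All (2 ≤_) ns → ∀ {r c} → r < sumV ns → c < sumV ns →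
           Mℤ ns r c ≡ 1ℤ - (δ c r + δ c (blockSuc ns r))
  Mℤ-row ns ns≥2 {r} {c} r<n c<n = trans (fromBool-not (blockEntry ns r c)) (cong (λ z → 1ℤ - z) (blockEntry-δ ns ns≥2 r<n c<n))

  Mℤ-column : ∀ {m} (ns : Vec ℕ m) → VecAll.All (2 ≤_) ns → ∀ {r c} → r < sumV ns → c < sumV ns →
              Mℤ ns r c ≡ 1ℤ - (δ r c + δ r (blockPred ns c))
  Mℤ-column ns ns≥2 {r} {c} r<n c<n =
    trans (Mℤ-row ns ns≥2 r<n c<n) (cong (λ z → 1ℤ - z) (cong₂ _+_ (δ-sym c r) (δ-blockSuc ns r<n c<n)))

  M·x : ∀ {m} (ns : Vec ℕ m) → VecAll.All (2 ≤_) ns → (x : ℕ → ℤ) → ∀ {r} → r < sumV ns →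
        ∑ (sumV ns) (λ c → Mℤ ns r c * x c) ≡ ∑ (sumV ns) x - (x r + x (blockSuc ns r))
  M·x ns ns≥2 x {r} r<n =
    ∑-twoPoint-complement (sumV ns) (Mℤ ns r) x r<n (blockSuc-< ns r<n) (λ c c<n → Mℤ-row ns ns≥2 r<n c<n)

  y·M : ∀ {m} (ns : Vec ℕ m) → VecAll.All (2 ≤_) ns → (y : ℕ → ℤ) → ∀ {c} → c < sumV ns →
        ∑ (sumV ns) (λ r → y r * Mℤ ns r c) ≡ ∑ (sumV ns) y - (y c + y (blockPred ns c))
  y·M ns ns≥2 y {c} c<n = trans (∑-cong (sumV ns) (λ r _ → ℤₚ.*-comm (y r) _))
    (∑-twoPoint-complement (sumV ns) (λ r → Mℤ ns r c) y c<n (blockPred-< ns c<n) (λ r r<n → Mℤ-column ns ns≥2 r<n c<n))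

module RightKernel where

  open import Data.Integer using (+_; _+_; _*_; _-_)
  open Sums
  open BlockIndexing
  open LinearAlgebra
  open ComplementMatrix

  firstIndices : ∀ {m} → Vec ℕ m → List ℕ
  firstIndices []       = []
  firstIndices (k ∷ ks) = 0 ∷ map (k ℕ.+_) (firstIndices ks)

  length-firstIndices : ∀ {m} (ns : Vec ℕ m) → length (firstIndices ns) ≡ m
  length-firstIndices []       = refl
  length-firstIndices (k ∷ ks) = cong suc (trans (Listₚ.length-map (k ℕ.+_) (firstIndices ks)) (length-firstIndices ks))

  firstIndices-< : ∀ {m} (ns : Vec ℕ m) → VecAll.All (2 ≤_) ns → All (_< sumV ns) (firstIndices ns)
  firstIndices-< []       []           = []
  firstIndices-< (k ∷ ks) (2≤k ∷ ks≥2) = ℕₚ.<-≤-trans (ℕₚ.<-≤-trans (s≤s z≤n) 2≤k) (ℕₚ.m≤m+n k _)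
    ∷ Allₚ.map⁺ (All.map (ℕₚ.+-monoʳ-< k) (firstIndices-< ks ks≥2))

  alternating-zero : ∀ {m} (ns : Vec ℕ m) (x : ℕ → ℤ) →
    (∀ r → r < sumV ns → x r + x (blockSuc ns r) ≡ 0ℤ) → All (λ f → x f ≡ 0ℤ) (firstIndices ns) →
    ∀ r → r < sumV ns → x r ≡ 0ℤ
  alternating-zero (k ∷ ks) x alt (x₀≡0 ∷ firsts) r r<n with r ℕ.<? k
  ... | yes r<k = inBlock r r<k
    where
    inBlock : ∀ r → r < k → x r ≡ 0ℤ
    inBlock zero    _      = x₀≡0
    inBlock (suc r) 1+r<k = begin
      x (suc r)              ≡⟨ ℤₚ.+-identityˡ _ ⟨
      0ℤ + x (suc r)         ≡⟨ cong (_+ x (suc r)) (inBlock r r<k′) ⟨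
      x r + x (suc r)        ≡⟨ cong (λ s → x r + x s) next≡ ⟨
      x r + x (blockSuc (k ∷ ks) r) ≡⟨ alt r (ℕₚ.<-≤-trans r<k′ (ℕₚ.m≤m+n k _)) ⟩
      0ℤ                     ∎
      where
      open ≡-Reasoning
      r<k′ : r < k
      r<k′ = ℕₚ.<-trans (ℕₚ.n<1+n r) 1+r<k
      next≡ : blockSuc (k ∷ ks) r ≡ suc r
      next≡ rewrite <ᵇ-true r<k′ = cycSuc-notLast (λ 1+r≡k → ℕₚ.<-irrefl 1+r≡k 1+r<k)
  ... | no r≮k = trans (cong x (sym (m+[n∸m]≡n′ r≮k)))
    (alternating-zero ks (x ∘ (k ℕ.+_)) alt′ (Allₚ.map⁻ firsts) (r ∸ k) (∸-<-+ r<n r≮k))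
    where
    alt′ : ∀ i → i < sumV ks → x (k ℕ.+ i) + x (k ℕ.+ blockSuc ks i) ≡ 0ℤ
    alt′ i i<s = trans (cong (λ s → x (k ℕ.+ i) + x s) (sym (blockSuc-shift k ks i))) (alt (k ℕ.+ i) (ℕₚ.+-monoʳ-< k i<s))

  -- Each row of M misses exactly two entries, so M x = 0 forces x r + x (blockSuc r) = Σ x for all r;
  -- summing over r gives 2 Σ x = n Σ x, hence Σ x = 0 unless n = 2.
  kernel-alternating : ∀ {m} (ns : Vec ℕ m) → VecAll.All (2 ≤_) ns → sumV ns ≢ 2 → (x : ℕ → ℤ) →
    (∀ r → r < sumV ns → ∑ (sumV ns) (λ c → Mℤ ns r c * x c) ≡ 0ℤ) →
    ∀ r → r < sumV ns → x r + x (blockSuc ns r) ≡ 0ℤ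
  kernel-alternating ns ns≥2 n≢2 x Mx≡0 r r<n = trans (pairs≡S r r<n) S≡0
    where
    n = sumV ns
    S = ∑ n x
    pairs≡S : ∀ r → r < n → x r + x (blockSuc ns r) ≡ S
    pairs≡S r r<n = sym (ℤₚ.i-j≡0⇒i≡j S _ (trans (sym (M·x ns ns≥2 x r<n)) (Mx≡0 r r<n)))
    S+S≡n*S : S + S ≡ + n * S
    S+S≡n*S = begin
      S + S                                   ≡⟨ cong (λ z → S + z) (∑-blockSuc ns x) ⟨
      S + ∑ n (x ∘ blockSuc ns)               ≡⟨ ∑-+ n x (x ∘ blockSuc ns) ⟨
      ∑ n (λ r → x r + x (blockSuc ns r))     ≡⟨ ∑-cong n pairs≡S ⟩
      ∑ n (λ _ → S)                           ≡⟨ ∑-const n S ⟩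
      + n * S                                 ∎
      where open ≡-Reasoning
    n-2≢0 : + n - (1ℤ + 1ℤ) ≢ 0ℤ
    n-2≢0 eq = n≢2 (ℤₚ.+-injective (ℤₚ.i-j≡0⇒i≡j (+ n) _ eq))
    S≡0 : S ≡ 0ℤ
    S≡0 = *-cancelˡ-≡0 n-2≢0 (trans (factor (+ n) S) (ℤₚ.i≡j⇒i-j≡0 (sym S+S≡n*S)))
      where
      factor : ∀ a s → (a - (1ℤ + 1ℤ)) * s ≡ a * s - (s + s)
      factor = solve-∀

  KernelConstraints : ∀ {m} → Vec ℕ m → List (ℕ → ℤ) → Set
  KernelConstraints ns w = ∀ x → Orthogonal (sumV ns) w x → ∀ r → r < sumV ns → ∑ (sumV ns) (λ c → Mℤ ns r c * x c) ≡ 0ℤ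

  -- That is, rank M ≥ n - m: ker M meets {x | x vanishes at the first index of every block} trivially.
  kernelConstraints-length : ∀ {m} (ns : Vec ℕ m) → VecAll.All (2 ≤_) ns → sumV ns ≢ 2 →
                             ∀ w → KernelConstraints ns w → sumV ns ≤ length w ℕ.+ m
  kernelConstraints-length {m} ns ns≥2 n≢2 w w⊆ker with length w ℕ.+ m ℕ.<? sumV ns
  ... | no ≮ = ℕₚ.≮⇒≥ ≮
  ... | yes short = ⊥-elim (xc≢0 (alternating-zero ns x (kernel-alternating ns ns≥2 n≢2 x (w⊆ker x x⊥w)) x-firsts c c<n))
    where
    n = sumV ns
    units = map (λ f i → δ i f) (firstIndices ns)
    fewer : length (w ++ units) < n
    fewer = subst (_< n) (sym (trans (Listₚ.length-++ w)
              (cong (length w ℕ.+_) (trans (Listₚ.length-map _ (firstIndices ns)) (length-firstIndices ns))))) short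
    solution = nontrivial-solution n (w ++ units) fewer
    x = proj₁ solution
    c = proj₁ (proj₁ (proj₂ solution))
    c<n = proj₁ (proj₂ (proj₁ (proj₂ solution)))
    xc≢0 = proj₂ (proj₂ (proj₁ (proj₂ solution)))
    x⊥w = proj₁ (Allₚ.++⁻ w (proj₂ (proj₂ solution)))
    x-firsts : All (λ f → x f ≡ 0ℤ) (firstIndices ns)
    x-firsts = All.zipWith (λ { (x⊥e , f<n) → trans (sym (∑-δ n _ x f<n)) x⊥e })
                 (Allₚ.map⁻ (proj₂ (Allₚ.++⁻ w (proj₂ (proj₂ solution)))) , firstIndices-< ns ns≥2)

  indicesExcept : ℕ → ℕ → List ℕ
  indicesExcept zero    t₀ = []
  indicesExcept (suc k) t₀ = if ⌊ k ℕ.≟ t₀ ⌋ then indicesExcept k t₀ else k ∷ indicesExcept k t₀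

  length-indicesExcept-≤ : ∀ k {t₀} → k ≤ t₀ → length (indicesExcept k t₀) ≡ k
  length-indicesExcept-≤ zero    _       = refl
  length-indicesExcept-≤ (suc k) {t₀} 1+k≤t₀ with k ℕ.≟ t₀
  ... | yes refl = ⊥-elim (ℕₚ.<-irrefl refl 1+k≤t₀)
  ... | no _     = cong suc (length-indicesExcept-≤ k (ℕₚ.<⇒≤ 1+k≤t₀))

  length-indicesExcept : ∀ k {t₀} → t₀ < k → suc (length (indicesExcept k t₀)) ≡ k
  length-indicesExcept (suc k) {t₀} t₀<1+k with k ℕ.≟ t₀
  ... | yes refl = cong suc (length-indicesExcept-≤ k ℕₚ.≤-refl)
  ... | no k≢t₀ = cong suc (length-indicesExcept k (ℕₚ.≤∧≢⇒< (ℕₚ.≤-pred t₀<1+k) (k≢t₀ ∘ sym)))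

  indicesExcept-all : ∀ {P : ℕ → Set} k {t₀} → All P (indicesExcept k t₀) → ∀ t → t < k → t ≢ t₀ → P t
  indicesExcept-all (suc k) {t₀} Ps t t<1+k t≢t₀ with k ℕ.≟ t₀ | ℕₚ.m≤n⇒m<n∨m≡n (ℕₚ.≤-pred t<1+k)
  ... | yes refl | inj₁ t<k   = indicesExcept-all k Ps t t<k t≢t₀
  ... | yes refl | inj₂ refl  = ⊥-elim (t≢t₀ refl)
  ... | no _     | inj₁ t<k   = indicesExcept-all k (All.tail Ps) t t<k t≢t₀
  ... | no _     | inj₂ refl  = All.head Ps

  kernelConstraints-except : ∀ {m} (ns : Vec ℕ m) → VecAll.All (2 ≤_) ns → sumV ns ≢ 2 →
    ∀ k {t₀} → t₀ < k → (w : ℕ → ℕ → ℤ) →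
    (∀ x → (∀ t → t < k → t ≢ t₀ → dot (sumV ns) (w t) x ≡ 0ℤ) →
           ∀ r → r < sumV ns → ∑ (sumV ns) (λ c → Mℤ ns r c * x c) ≡ 0ℤ) →
    sumV ns ≤ (k ∸ 1) ℕ.+ m
  kernelConstraints-except {m} ns ns≥2 n≢2 k {t₀} t₀<k w w⊆ker =
    subst (λ l → sumV ns ≤ l ℕ.+ m) (trans (Listₚ.length-map w (indicesExcept k t₀)) length≡)
      (kernelConstraints-length ns ns≥2 n≢2 (map w (indicesExcept k t₀))
        (λ x x⊥w → w⊆ker x (indicesExcept-all k (Allₚ.map⁻ x⊥w))))
    where
    length≡ : length (indicesExcept k t₀) ≡ k ∸ 1
    length≡ = trans (sym (ℕₚ.m+n∸m≡n 1 _)) (cong (_∸ 1) (length-indicesExcept k t₀<k))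

module LeftKernel where

  open import Data.Integer using (_+_; _*_; _-_; -_)
  open Sums
  open LinearAlgebra
  open BlockIndexing
  open ComplementMatrix

  alternating : ℕ → ℤ
  alternating zero    = 1ℤ
  alternating (suc r) = - alternating r

  alternating-even : ∀ j → alternating (j ℕ.+ j) ≡ 1ℤ
  alternating-even zero    = refl
  alternating-even (suc j) rewrite ℕₚ.+-suc j j = trans (ℤₚ.neg-involutive _) (alternating-even j)

  ∑-alternating-even : ∀ j → ∑ (j ℕ.+ j) alternating ≡ 0ℤ
  ∑-alternating-even zero    = refl
  ∑-alternating-even (suc j) rewrite ℕₚ.+-suc j j =
    cong (λ z → 1ℤ + (- 1ℤ + z)) (trans (∑-cong (j ℕ.+ j) (λ i _ → ℤₚ.neg-involutive (alternating i))) (∑-alternating-even j))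

  alternating-last : ∀ {k} → Even k → 2 ≤ k → alternating (k ∸ 1) ≡ - 1ℤ
  alternating-last (suc j , refl) _ rewrite ℕₚ.+-suc j j = cong -_ (alternating-even j)

  truncate : ℕ → (ℕ → ℤ) → ℕ → ℤ
  truncate k a r = if r <ᵇ k then a r else 0ℤ

  shiftBy : ℕ → (ℕ → ℤ) → ℕ → ℤ
  shiftBy k a r = if r <ᵇ k then 0ℤ else a (r ∸ k)

  shiftBy-inner : ∀ k a {r} → r < k → shiftBy k a r ≡ 0ℤ
  shiftBy-inner k a r<k rewrite <ᵇ-true r<k = refl

  shiftBy-outer : ∀ k a i → shiftBy k a (k ℕ.+ i) ≡ a i
  shiftBy-outer k a i rewrite <ᵇ-false (m+n≮m k i) | ℕₚ.m+n∸m≡n k i = refl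

  dot-truncate : ∀ k s a u → dot (k ℕ.+ s) (truncate k a) u ≡ dot k a u
  dot-truncate k s a u = trans
    (∑-split-cong k s (λ r r<k → cong (λ b → (if b then a r else 0ℤ) * u r) (<ᵇ-true r<k))
                      (λ i → cong (λ b → (if b then a (k ℕ.+ i) else 0ℤ) * u (k ℕ.+ i)) (<ᵇ-false (m+n≮m k i))))
    (trans (cong (λ z → dot k a u + z) (∑-zero s)) (ℤₚ.+-identityʳ _))

  dot-shiftBy : ∀ k s a u → dot (k ℕ.+ s) (shiftBy k a) u ≡ dot s a (u ∘ (k ℕ.+_))
  dot-shiftBy k s a u = trans
    (∑-split-cong k s (λ r r<k → trans (cong (_* u r) (shiftBy-inner k a r<k)) (ℤₚ.*-zeroˡ (u r)))
                      (λ i → cong (_* u (k ℕ.+ i)) (shiftBy-outer k a i)))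
    (trans (cong (_+ dot s a (u ∘ (k ℕ.+_))) (∑-zero k)) (ℤₚ.+-identityˡ _))

  leftKernelBasis : ∀ {m} → Vec ℕ m → List (ℕ → ℤ)
  leftKernelBasis []       = []
  leftKernelBasis (k ∷ ks) = truncate k alternating ∷ map (shiftBy k) (leftKernelBasis ks)

  LeftNull : ∀ {m} → Vec ℕ m → (ℕ → ℤ) → Set
  LeftNull ns a = ∑ (sumV ns) a ≡ 0ℤ × (∀ c → c < sumV ns → a c + a (blockPred ns c) ≡ 0ℤ)

  leftNull-annihilates : ∀ {m} (ns : Vec ℕ m) → VecAll.All (2 ≤_) ns → ∀ {a} → LeftNull ns a →
                         ∀ c → c < sumV ns → ∑ (sumV ns) (λ r → a r * Mℤ ns r c) ≡ 0ℤ
  leftNull-annihilates ns ns≥2 {a} (∑a≡0 , pairs≡0) c c<n =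
    trans (y·M ns ns≥2 a c<n) (cong₂ _-_ ∑a≡0 (pairs≡0 c c<n))

  leftKernelBasis-leftNull : ∀ {m} (ns : Vec ℕ m) → VecAll.All (2 ≤_) ns → VecAll.All Even ns →
                             All (LeftNull ns) (leftKernelBasis ns)
  leftKernelBasis-leftNull []       _            _                = []
  leftKernelBasis-leftNull (k ∷ ks) (2≤k ∷ ks≥2) (k-even ∷ ks-even) =
    (∑-first , pairs-first) ∷ Allₚ.map⁺ (All.map shifted (leftKernelBasis-leftNull ks ks≥2 ks-even))
    where
    ∑-first : ∑ (k ℕ.+ sumV ks) (truncate k alternating) ≡ 0ℤ
    ∑-first = begin
      ∑ (k ℕ.+ sumV ks) (truncate k alternating)
        ≡⟨ ∑-split-cong k (sumV ks) (λ r r<k → cong (λ b → if b then alternating r else 0ℤ) (<ᵇ-true r<k))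
                                    (λ i → cong (λ b → if b then alternating (k ℕ.+ i) else 0ℤ) (<ᵇ-false (m+n≮m k i))) ⟩
      ∑ k alternating + ∑ (sumV ks) (λ _ → 0ℤ)
        ≡⟨ cong₂ _+_ (trans (cong (λ l → ∑ l alternating) (proj₂ k-even)) (∑-alternating-even (proj₁ k-even))) (∑-zero (sumV ks)) ⟩
      0ℤ ∎
      where open ≡-Reasoning
    pairs-first : ∀ c → c < k ℕ.+ sumV ks →
                  truncate k alternating c + truncate k alternating (blockPred (k ∷ ks) c) ≡ 0ℤ
    pairs-first c c<n with c ℕ.<? k
    ... | yes c<k rewrite blockPred-inner ks c<k | <ᵇ-true c<k | <ᵇ-true (cycPred-< c<k) = inner c
      where
      inner : ∀ c → alternating c + alternating (cycPred k c) ≡ 0ℤ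
      inner zero    = cong (λ z → 1ℤ + z) (alternating-last k-even 2≤k)
      inner (suc c) = ℤₚ.+-inverseˡ (alternating c)
    ... | no c≮k rewrite blockPred-outer ks c≮k | <ᵇ-false c≮k | <ᵇ-false (m+n≮m k (blockPred ks (c ∸ k))) = refl
    shifted : ∀ {a} → LeftNull ks a → LeftNull (k ∷ ks) (shiftBy k a)
    shifted {a} (∑a≡0 , pairs≡0) = ∑-shifted , pairs-shifted
      where
      ∑-shifted : ∑ (k ℕ.+ sumV ks) (shiftBy k a) ≡ 0ℤ
      ∑-shifted = trans (∑-split-cong k (sumV ks) (λ r r<k → shiftBy-inner k a r<k) (shiftBy-outer k a))
                        (cong₂ _+_ (∑-zero k) ∑a≡0)
      pairs-shifted : ∀ c → c < k ℕ.+ sumV ks → shiftBy k a c + shiftBy k a (blockPred (k ∷ ks) c) ≡ 0ℤ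
      pairs-shifted c c<n with c ℕ.<? k
      ... | yes c<k rewrite blockPred-inner ks c<k =
        cong₂ _+_ (shiftBy-inner k a c<k) (shiftBy-inner k a (cycPred-< c<k))
      ... | no c≮k rewrite blockPred-outer ks c≮k | shiftBy-outer k a (blockPred ks (c ∸ k)) =
        trans (cong (_+ a (blockPred ks (c ∸ k))) (trans (cong (shiftBy k a) (sym (m+[n∸m]≡n′ c≮k))) (shiftBy-outer k a (c ∸ k))))
              (pairs≡0 (c ∸ k) (∸-<-+ c<n c≮k))

  telescope : (ℕ → ℤ) → ℕ → ℤ
  telescope u zero    = 0ℤ
  telescope u (suc j) = u j - telescope u j

  alternating-telescope : ∀ u j → alternating j * telescope u j ≡ - ∑ j (λ i → alternating i * u i)
  alternating-telescope u zero    = refl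
  alternating-telescope u (suc j) = begin
    - a * (u j - telescope u j)        ≡⟨ expand a (u j) (telescope u j) ⟩
    - (a * u j) + a * telescope u j    ≡⟨ cong (λ z → - (a * u j) + z) (alternating-telescope u j) ⟩
    - (a * u j) + - ∑ j au             ≡⟨ ℤₚ.neg-distrib-+ (a * u j) (∑ j au) ⟨
    - (a * u j + ∑ j au)               ≡⟨ cong -_ (ℤₚ.+-comm (a * u j) (∑ j au)) ⟩
    - (∑ j au + a * u j)               ≡⟨ cong -_ (∑-last j au) ⟨
    - ∑ (suc j) au                     ∎
    where
    open ≡-Reasoning
    a = alternating j
    au = λ i → alternating i * u i
    expand : ∀ a b c → (- a) * (b - c) ≡ - (a * b) + a * c
    expand = solve-∀

  pairSolution : ∀ {m} → Vec ℕ m → (ℕ → ℤ) → ℕ → ℤ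
  pairSolution []       u r = 0ℤ
  pairSolution (k ∷ ks) u r = if r <ᵇ k then telescope u r else pairSolution ks (u ∘ (k ℕ.+_)) (r ∸ k)

  pairSolution-shift : ∀ k {m} (ks : Vec ℕ m) u i → pairSolution (k ∷ ks) u (k ℕ.+ i) ≡ pairSolution ks (u ∘ (k ℕ.+_)) i
  pairSolution-shift k ks u i rewrite <ᵇ-false (m+n≮m k i) | ℕₚ.m+n∸m≡n k i = refl

  -- Closing the cycle of a block needs the alternating sum of u over that block to vanish.
  pairSolution-solves : ∀ {m} (ns : Vec ℕ m) → VecAll.All Even ns → (u : ℕ → ℤ) →
    Orthogonal (sumV ns) (leftKernelBasis ns) u →
    ∀ r → r < sumV ns → pairSolution ns u r + pairSolution ns u (blockSuc ns r) ≡ u r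
  pairSolution-solves (k ∷ ks) (k-even ∷ ks-even) u (u⊥first ∷ u⊥rest) r r<n with r ℕ.<? k
  ... | yes r<k rewrite <ᵇ-true r<k | <ᵇ-true (cycSuc-< r<k) = inner (suc r ℕ.≟ k)
    where
    closes : telescope u k ≡ 0ℤ
    closes = begin
      telescope u k                             ≡⟨ ℤₚ.*-identityˡ _ ⟨
      1ℤ * telescope u k                        ≡⟨ cong (_* telescope u k) (trans (cong alternating (proj₂ k-even)) (alternating-even (proj₁ k-even))) ⟨
      alternating k * telescope u k             ≡⟨ alternating-telescope u k ⟩
      - ∑ k (λ i → alternating i * u i)         ≡⟨ cong -_ (trans (sym (dot-truncate k (sumV ks) alternating u)) u⊥first) ⟩
      0ℤ                                        ∎
      where open ≡-Reasoning
    inner : Dec (suc r ≡ k) → telescope u r + telescope u (cycSuc k r) ≡ u r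
    inner (yes 1+r≡k) rewrite cycSuc-last 1+r≡k =
      trans (ℤₚ.+-identityʳ _) (sym (ℤₚ.i-j≡0⇒i≡j (u r) _ (trans (cong (telescope u) 1+r≡k) closes)))
    inner (no 1+r≢k) rewrite cycSuc-notLast 1+r≢k = cancel (telescope u r) (u r)
      where
      cancel : ∀ a b → a + (b - a) ≡ b
      cancel = solve-∀
  ... | no r≮k rewrite <ᵇ-false r≮k | pairSolution-shift k ks u (blockSuc ks (r ∸ k)) =
    trans (pairSolution-solves ks ks-even (u ∘ (k ℕ.+_))
             (All.map (λ {a} u⊥a → trans (sym (dot-shiftBy k (sumV ks) a u)) u⊥a) (Allₚ.map⁻ u⊥rest))
             (r ∸ k) (∸-<-+ r<n r≮k))
          (cong u (m+[n∸m]≡n′ r≮k))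

  pairSolution-zero : ∀ {m} (ns : Vec ℕ m) (u : ℕ → ℤ) → (∀ i → i < sumV ns → u i ≡ 0ℤ) →
                      ∀ r → r < sumV ns → pairSolution ns u r ≡ 0ℤ
  pairSolution-zero (k ∷ ks) u u≡0 r r<n with r ℕ.<? k
  ... | yes r<k rewrite <ᵇ-true r<k = inner r r<k
    where
    inner : ∀ r → r < k → telescope u r ≡ 0ℤ
    inner zero    _      = refl
    inner (suc r) 1+r<k = cong₂ _-_ (u≡0 r (ℕₚ.<-≤-trans r<k′ (ℕₚ.m≤m+n k _))) (inner r r<k′)
      where r<k′ = ℕₚ.<-trans (ℕₚ.n<1+n r) 1+r<k
  ... | no r≮k rewrite <ᵇ-false r≮k =
    pairSolution-zero ks (u ∘ (k ℕ.+_)) (λ i i<s → u≡0 (k ℕ.+ i) (ℕₚ.+-monoʳ-< k i<s)) (r ∸ k) (∸-<-+ r<n r≮k)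

  ∑-pairSolution : ∀ {m} (ns : Vec ℕ m) → VecAll.All Even ns → (u : ℕ → ℤ) →
    Orthogonal (sumV ns) (leftKernelBasis ns) u →
    ∑ (sumV ns) (pairSolution ns u) + ∑ (sumV ns) (pairSolution ns u) ≡ ∑ (sumV ns) u
  ∑-pairSolution ns ns-even u u⊥ = begin
    ∑ n g + ∑ n g                              ≡⟨ cong (λ z → ∑ n g + z) (∑-blockSuc ns g) ⟨
    ∑ n g + ∑ n (g ∘ blockSuc ns)              ≡⟨ ∑-+ n g (g ∘ blockSuc ns) ⟨
    ∑ n (λ r → g r + g (blockSuc ns r))        ≡⟨ ∑-cong n (pairSolution-solves ns ns-even u u⊥) ⟩
    ∑ n u                                      ∎
    where
    open ≡-Reasoning
    n = sumV ns
    g = pairSolution ns u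

module Factorisation {m} (ns : Vec ℕ m) (ns≥2 : VecAll.All (2 ≤_) ns) (n≢2 : sumV ns ≢ 2)
                     (k : ℕ) (U V : ℕ → ℕ → ℤ)
                     (M≡UVᵀ : ∀ {r c} → r < sumV ns → c < sumV ns →
                               ComplementMatrix.Mℤ ns r c ≡ Sums.∑ k (λ t → U r t ℤ.* V c t)) where

  open import Data.Integer using (_*_; _-_)
  open Sums
  open LinearAlgebra
  open ComplementMatrix
  open RightKernel

  n = sumV ns

  row column : ℕ → ℕ → ℤ
  row    t r = U r t
  column t c = V c t

  M·x-factorised : ∀ x {r} → r < n → ∑ n (λ c → Mℤ ns r c * x c) ≡ ∑ k (λ t → U r t * dot n (column t) x)
  M·x-factorised x {r} r<n = begin
    ∑ n (λ c → Mℤ ns r c * x c)                          ≡⟨ ∑-cong n (λ c c<n → cong (_* x c) (M≡UVᵀ r<n c<n)) ⟩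
    ∑ n (λ c → ∑ k (λ t → U r t * V c t) * x c)          ≡⟨ ∑-cong n (λ c _ → trans (ℤₚ.*-comm _ (x c)) (sym (∑-*ˡ k (x c) _))) ⟩
    ∑ n (λ c → ∑ k (λ t → x c * (U r t * V c t)))        ≡⟨ ∑-cong n (λ c _ → ∑-cong k (λ t _ → rearrange (x c) (U r t) (V c t))) ⟩
    ∑ n (λ c → ∑ k (λ t → U r t * (V c t * x c)))        ≡⟨ ∑-swap n k _ ⟩
    ∑ k (λ t → ∑ n (λ c → U r t * (V c t * x c)))        ≡⟨ ∑-cong k (λ t _ → ∑-*ˡ n (U r t) _) ⟩
    ∑ k (λ t → U r t * dot n (column t) x)               ∎
    where
    open ≡-Reasoning
    rearrange : ∀ a b c → a * (b * c) ≡ b * (c * a)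
    rearrange = solve-∀

  columns-orthogonal⇒kernel : ∀ x → (∀ t → t < k → dot n (column t) x ≡ 0ℤ) →
                              ∀ r → r < n → ∑ n (λ c → Mℤ ns r c * x c) ≡ 0ℤ
  columns-orthogonal⇒kernel x x⊥ r r<n = trans (M·x-factorised x r<n)
    (trans (∑-cong k (λ t t<k → trans (cong (U r t *_) (x⊥ t t<k)) (ℤₚ.*-zeroʳ (U r t)))) (∑-zero k))

  rank-≤-columns : n ≤ k ℕ.+ m
  rank-≤-columns = kernelConstraints-except ns ns≥2 n≢2 (suc k) (ℕₚ.n<1+n k) column
    (λ x x⊥ → columns-orthogonal⇒kernel x (λ t t<k → x⊥ t (ℕₚ.m<n⇒m<1+n t<k) (ℕₚ.<⇒≢ t<k)))

  columns-dependent : (β : ℕ → ℤ) → (∀ c → c < n → ∑ k (λ t → β t * V c t) ≡ 0ℤ) →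
                      ∀ {t₀} → t₀ < k → β t₀ ≢ 0ℤ → n ≤ (k ∸ 1) ℕ.+ m
  columns-dependent β βV≡0 {t₀} t₀<k βt₀≢0 = kernelConstraints-except ns ns≥2 n≢2 k t₀<k column
    (λ x x⊥ → columns-orthogonal⇒kernel x (orthogonal-t₀ x x⊥))
    where
    orthogonal-t₀ : ∀ x → (∀ t → t < k → t ≢ t₀ → dot n (column t) x ≡ 0ℤ) → ∀ t → t < k → dot n (column t) x ≡ 0ℤ
    orthogonal-t₀ x x⊥ t t<k with t ℕ.≟ t₀
    ... | no t≢t₀ = x⊥ t t<k t≢t₀
    ... | yes refl = *-cancelˡ-≡0 βt₀≢0 (begin
      β t * dot n (column t) x                        ≡⟨ ∑-single k (λ s → β s * dot n (column s) x) t t<k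
                                                           (λ s s<k s≢t → trans (cong (β s *_) (x⊥ s s<k s≢t)) (ℤₚ.*-zeroʳ (β s))) ⟨
      ∑ k (λ s → β s * ∑ n (λ c → V c s * x c))        ≡⟨ ∑-cong k (λ s _ → sym (∑-*ˡ n (β s) _)) ⟩
      ∑ k (λ s → ∑ n (λ c → β s * (V c s * x c)))      ≡⟨ ∑-swap k n _ ⟩
      ∑ n (λ c → ∑ k (λ s → β s * (V c s * x c)))      ≡⟨ ∑-cong n (λ c c<n → vanishes c c<n) ⟩
      ∑ n (λ _ → 0ℤ)                                   ≡⟨ ∑-zero n ⟩
      0ℤ                                               ∎)
      where
      open ≡-Reasoning
      rearrange : ∀ a b c → a * (b * c) ≡ c * (a * b)
      rearrange = solve-∀
      vanishes : ∀ c → c < n → ∑ k (λ s → β s * (V c s * x c)) ≡ 0ℤ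
      vanishes c c<n = trans (∑-cong k (λ s _ → rearrange (β s) (V c s) (x c)))
        (trans (∑-*ˡ k (x c) _) (trans (cong (x c *_) (βV≡0 c c<n)) (ℤₚ.*-zeroʳ (x c))))

  -- If the rows are dependent, the constraints γ t₀ v_t - γ t v_t₀ (t ≠ t₀) already force M x = 0.
  rows-dependent : (γ : ℕ → ℤ) → (∀ r → r < n → ∑ k (λ t → γ t * U r t) ≡ 0ℤ) →
                   ∀ {t₀} → t₀ < k → γ t₀ ≢ 0ℤ → n ≤ (k ∸ 1) ℕ.+ m
  rows-dependent γ γU≡0 {t₀} t₀<k γt₀≢0 = kernelConstraints-except ns ns≥2 n≢2 k t₀<k w kernel
    where
    w : ℕ → ℕ → ℤ
    w t c = γ t₀ * V c t - γ t * V c t₀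
    dot-w : ∀ x t → dot n (w t) x ≡ γ t₀ * dot n (column t) x - γ t * dot n (column t₀) x
    dot-w x t = trans (∑-cong n (λ c _ → distrib (γ t₀) (V c t) (γ t) (V c t₀) (x c)))
      (trans (∑-sub n _ _) (cong₂ _-_ (∑-*ˡ n (γ t₀) _) (∑-*ˡ n (γ t) _)))
      where
      distrib : ∀ a b c d e → (a * b - c * d) * e ≡ a * (b * e) - c * (d * e)
      distrib = solve-∀
    kernel : ∀ x → (∀ t → t < k → t ≢ t₀ → dot n (w t) x ≡ 0ℤ) →
             ∀ r → r < n → ∑ n (λ c → Mℤ ns r c * x c) ≡ 0ℤ
    kernel x x⊥w r r<n = *-cancelˡ-≡0 γt₀≢0 (begin
      γ t₀ * ∑ n (λ c → Mℤ ns r c * x c)       ≡⟨ cong (γ t₀ *_) (M·x-factorised x r<n) ⟩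
      γ t₀ * ∑ k (λ t → U r t * D t)           ≡⟨ ∑-*ˡ k (γ t₀) _ ⟨
      ∑ k (λ t → γ t₀ * (U r t * D t))         ≡⟨ ∑-cong k termwise ⟩
      ∑ k (λ t → D t₀ * (γ t * U r t))         ≡⟨ ∑-*ˡ k (D t₀) _ ⟩
      D t₀ * ∑ k (λ t → γ t * U r t)           ≡⟨ cong (D t₀ *_) (γU≡0 r r<n) ⟩
      D t₀ * 0ℤ                                ≡⟨ ℤₚ.*-zeroʳ (D t₀) ⟩
      0ℤ                                       ∎)
      where
      open ≡-Reasoning
      D = λ t → dot n (column t) x
      proportional : ∀ t → t < k → γ t₀ * D t ≡ γ t * D t₀
      proportional t t<k with t ℕ.≟ t₀
      ... | yes refl = refl
      ... | no t≢t₀ = ℤₚ.i-j≡0⇒i≡j _ _ (trans (sym (dot-w x t)) (x⊥w t t<k t≢t₀))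
      termwise : ∀ t → t < k → γ t₀ * (U r t * D t) ≡ D t₀ * (γ t * U r t)
      termwise t t<k = trans (swap (γ t₀) (U r t) (D t)) (trans (cong (U r t *_) (proportional t t<k)) (regroup (U r t) (γ t) (D t₀)))
        where
        swap : ∀ a b c → a * (b * c) ≡ b * (a * c)
        swap = solve-∀
        regroup : ∀ a b c → a * (b * c) ≡ c * (b * a)
        regroup = solve-∀

module AreaArgument {m} (ns : Vec ℕ m) (ns≥2 : VecAll.All (2 ≤_) ns) (ns-even : VecAll.All BlockIndexing.Even ns)
                    (1≤m : 1 ≤ m) (big : 2 ℕ.* m ℕ.+ 2 ≤ sumV ns) (k : ℕ) (u v : ℕ → ℕ → ℕ)
                    (M≡UVᵀ : ∀ {r c} → r < sumV ns → c < sumV ns →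
                              ComplementMatrix.Mℤ ns r c ≡ Sums.∑ k (λ t → ℤ.+ u r t ℤ.* ℤ.+ v c t)) where

  open import Data.Integer using (+_; _+_; _*_; _-_)
  open import Data.Nat.Divisibility using (divides; ∣⇒≤)
  open import Data.Nat.Tactic.RingSolver using () renaming (solve-∀ to solve-∀ℕ)
  open import Relation.Nullary using (¬?)
  open import Relation.Nullary.Decidable using (decidable-stable)
  open Sums
  open LinearAlgebra
  open BlockIndexing using (blockSuc)
  open ComplementMatrix
  open LeftKernel

  4≤n : 4 ≤ sumV ns
  4≤n = ℕₚ.≤-trans (ℕₚ.+-monoˡ-≤ 2 (ℕₚ.*-monoʳ-≤ 2 1≤m)) big

  n≢2 : sumV ns ≢ 2
  n≢2 n≡2 = ℕₚ.<⇒≱ (s≤s (s≤s (s≤s z≤n))) (subst (4 ≤_) n≡2 4≤n)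

  open Factorisation ns ns≥2 n≢2 k (λ r t → + u r t) (λ c t → + v c t) M≡UVᵀ

  height width area : ℕ → ℕ
  height s = ∑ℕ n (λ r → u r s)
  width  s = ∑ℕ n (λ c → v c s)
  area   s = height s ℕ.* width s

  n₂ = n ∸ 2
  D = + (n₂ ℕ.+ n₂)

  n≡n₂+2 : + n ≡ + n₂ + 1ℤ + 1ℤ
  n≡n₂+2 = cong +_ (trans (sym (ℕₚ.m∸n+n≡m {n} {2} (ℕₚ.≤-trans (s≤s (s≤s z≤n)) 4≤n))) (sym (ℕₚ.+-assoc n₂ 1 1)))

  D≡n₂+n₂ : D ≡ + n₂ + + n₂
  D≡n₂+n₂ = ℤₚ.pos-+ n₂ n₂

  n₂≢0 : n₂ ≢ 0
  n₂≢0 n₂≡0 = n≢2 (trans (sym (ℕₚ.m∸n+n≡m {n} {2} (ℕₚ.≤-trans (s≤s (s≤s z≤n)) 4≤n))) (cong (ℕ._+ 2) n₂≡0))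

  Balanced : ℕ → Set
  Balanced s = Orthogonal n (leftKernelBasis ns) (row s)

  -- Chosen so that M y_s = D u_s: the pairSolution term compensates the two zeros in each row of M.
  y : ℕ → ℕ → ℤ
  y s c = + height s - D * pairSolution ns (row s) c

  M·y : ∀ s → Balanced s → ∀ {r} → r < n → ∑ n (λ c → Mℤ ns r c * y s c) ≡ D * + u r s
  M·y s balanced {r} r<n = begin
    ∑ n (λ c → Mℤ ns r c * y s c)       ≡⟨ M·x ns ns≥2 (y s) r<n ⟩
    ∑ n (y s) - (y s r + y s (blockSuc ns r))
      ≡⟨ cong (λ z → z - (y s r + y s (blockSuc ns r))) (trans (∑-sub n _ _) (cong₂ _-_ (∑-const n _) (∑-*ˡ n D g))) ⟩
    + n * + height s - D * ∑ n g - (y s r + y s (blockSuc ns r))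
      ≡⟨ collect (+ n) (+ height s) D (+ u r s) (∑ n g) (g r) (g (blockSuc ns r)) (+ n₂) n≡n₂+2 D≡n₂+n₂
           (sym (trans (∑-pairSolution ns ns-even (row s) balanced) (∑-pos n (λ r → u r s))))
           (sym (pairSolution-solves ns ns-even (row s) balanced r r<n)) ⟩
    D * + u r s                         ∎
    where
    open ≡-Reasoning
    g = pairSolution ns (row s)
    identity : ∀ n₂ G a b → (n₂ + 1ℤ + 1ℤ) * (G + G) - (n₂ + n₂) * G - ((G + G - (n₂ + n₂) * a) + (G + G - (n₂ + n₂) * b))
                            ≡ (n₂ + n₂) * (a + b)
    identity = solve-∀
    collect : ∀ N H D′ w G a b n₂ → N ≡ n₂ + 1ℤ + 1ℤ → D′ ≡ n₂ + n₂ → H ≡ G + G → w ≡ a + b →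
              N * H - D′ * G - ((H - D′ * a) + (H - D′ * b)) ≡ D′ * w
    collect _ _ _ _ G a b n₂ refl refl refl refl = identity n₂ G a b

  unbalanced⇒ : ∀ {a} → LeftNull ns a → ∀ {t₀} → t₀ < k → dot n a (row t₀) ≢ 0ℤ → n ≤ (k ∸ 1) ℕ.+ m
  unbalanced⇒ {a} a-null t₀<k a·u≢0 = columns-dependent (λ t → dot n a (row t)) dependence t₀<k a·u≢0
    where
    dependence : ∀ c → c < n → ∑ k (λ t → dot n a (row t) * + v c t) ≡ 0ℤ
    dependence c c<n = begin
      ∑ k (λ t → dot n a (row t) * + v c t)              ≡⟨ ∑-cong k (λ t _ → trans (ℤₚ.*-comm _ (+ v c t)) (sym (∑-*ˡ n (+ v c t) _))) ⟩
      ∑ k (λ t → ∑ n (λ r → + v c t * (a r * + u r t)))  ≡⟨ ∑-swap k n _ ⟩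
      ∑ n (λ r → ∑ k (λ t → + v c t * (a r * + u r t)))  ≡⟨ ∑-cong n (λ r r<n → factor r r<n) ⟩
      ∑ n (λ r → a r * Mℤ ns r c)                        ≡⟨ leftNull-annihilates ns ns≥2 a-null c c<n ⟩
      0ℤ                                                 ∎
      where
      open ≡-Reasoning
      rearrange : ∀ w a b → w * (a * b) ≡ a * (b * w)
      rearrange = solve-∀
      factor : ∀ r → r < n → ∑ k (λ t → + v c t * (a r * + u r t)) ≡ a r * Mℤ ns r c
      factor r r<n = trans (∑-cong k (λ t _ → rearrange (+ v c t) (a r) (+ u r t)))
                       (trans (∑-*ˡ k (a r) _) (cong (a r *_) (sym (M≡UVᵀ r<n c<n))))

  mismatch⇒ : ∀ {s₀} → s₀ < k → Balanced s₀ → dot n (column s₀) (y s₀) ≢ D → n ≤ (k ∸ 1) ℕ.+ m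
  mismatch⇒ {s₀} s₀<k balanced mismatch = rows-dependent γ dependence s₀<k γs₀≢0
    where
    γ : ℕ → ℤ
    γ t = dot n (column t) (y s₀) - D * δ t s₀
    γs₀≢0 : γ s₀ ≢ 0ℤ
    γs₀≢0 γs₀≡0 = mismatch (ℤₚ.i-j≡0⇒i≡j _ _ (trans (cong (λ z → dot n (column s₀) (y s₀) - z)
                    (trans (sym (ℤₚ.*-identityʳ D)) (cong (D *_) (sym (δ-refl s₀))))) γs₀≡0))
    dependence : ∀ r → r < n → ∑ k (λ t → γ t * + u r t) ≡ 0ℤ
    dependence r r<n = begin
      ∑ k (λ t → γ t * + u r t)
        ≡⟨ trans (∑-cong k (λ t _ → distrib (dot n (column t) (y s₀)) D (δ t s₀) (+ u r t))) (∑-sub k _ _) ⟩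
      ∑ k (λ t → + u r t * dot n (column t) (y s₀)) - ∑ k (λ t → D * (δ t s₀ * + u r t))
        ≡⟨ cong₂ _-_ (sym (M·x-factorised (y s₀) r<n)) (trans (∑-*ˡ k D _) (cong (D *_) (∑-δ k s₀ _ s₀<k))) ⟩
      ∑ n (λ c → Mℤ ns r c * y s₀ c) - D * + u r s₀
        ≡⟨ ℤₚ.i≡j⇒i-j≡0 (M·y s₀ balanced r<n) ⟩
      0ℤ ∎
      where
      open ≡-Reasoning
      distrib : ∀ a b c w → (a - b * c) * w ≡ w * a - b * (c * w)
      distrib = solve-∀

  column·y : ∀ s → dot n (column s) (y s) ≡ + height s * + width s - D * dot n (column s) (pairSolution ns (row s))
  column·y s = trans (∑-cong n (λ c _ → distrib (+ v c s) (+ height s) D (pairSolution ns (row s) c)))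
    (trans (∑-sub n _ _) (cong₂ _-_ (trans (∑-*ˡ n (+ height s) _) (cong (+ height s *_) (∑-pos n (λ c → v c s))))
                                  (∑-*ˡ n D _)))
    where
    distrib : ∀ w H D′ g → w * (H - D′ * g) ≡ H * w - D′ * (w * g)
    distrib = solve-∀

  ∣ℤ⇒≤ : ∀ {a d} τ → + a ≡ + d * τ → a ≢ 0 → d ≤ a
  ∣ℤ⇒≤ {a} {d} τ a≡dτ a≢0 = ∣⇒≤ {{ℕ.≢-nonZero a≢0}}
    (divides ℤ.∣ τ ∣ (trans (cong ℤ.∣_∣ a≡dτ) (trans (ℤₚ.abs-* (+ d) τ) (ℕₚ.*-comm d _))))

  matched-area : ∀ {s} → s < k → dot n (column s) (y s) ≡ D → n₂ ℕ.+ n₂ ≤ area s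
  matched-area {s} s<k matched = ∣ℤ⇒≤ (1ℤ + dot n (column s) (pairSolution ns (row s))) area≡ area≢0
    where
    area≡ : + area s ≡ D * (1ℤ + dot n (column s) (pairSolution ns (row s)))
    area≡ = trans (ℤₚ.pos-* (height s) (width s)) (solve (trans (sym (column·y s)) matched))
      where
      identity : ∀ P D′ x → P - D′ * x + D′ * x ≡ P
      identity = solve-∀
      distrib : ∀ D′ x → D′ + D′ * x ≡ D′ * (1ℤ + x)
      distrib = solve-∀
      solve : ∀ {P D′ x} → P - D′ * x ≡ D′ → P ≡ D′ * (1ℤ + x)
      solve {P} {D′} {x} eq = trans (sym (identity P D′ x)) (trans (cong (_+ D′ * x) eq) (distrib D′ x))
    D≢0 : D ≢ 0ℤ
    D≢0 D≡0 = n₂≢0 (ℕₚ.m+n≡0⇒m≡0 n₂ (ℤₚ.+-injective D≡0))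
    area≢0 : area s ≢ 0
    area≢0 area≡0 with ℕₚ.m*n≡0⇒m≡0∨n≡0 (height s) area≡0
    ... | inj₁ height≡0 = D≢0 (trans (sym matched) (trans (∑-cong n (λ c c<n → trans (cong (+ v c s *_) (y≡0 c c<n)) (ℤₚ.*-zeroʳ (+ v c s)))) (∑-zero n)))
      where
      y≡0 : ∀ c → c < n → y s c ≡ 0ℤ
      y≡0 c c<n = trans (cong₂ (λ h g → h - D * g) (cong +_ height≡0)
                    (pairSolution-zero ns (row s) (λ r r<n → cong +_ (∑ℕ≡0⇒≡0 n _ height≡0 r r<n)) c c<n))
                    (cong (λ z → 0ℤ - z) (ℤₚ.*-zeroʳ D))
    ... | inj₂ width≡0 = D≢0 (trans (sym matched) (trans (∑-cong n (λ c c<n →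
            trans (cong (λ w → + w * y s c) (∑ℕ≡0⇒≡0 n _ width≡0 c c<n)) (ℤₚ.*-zeroˡ (y s c)))) (∑-zero n)))

  M-rowSum : ∀ {r} → r < n → ∑ n (Mℤ ns r) ≡ + n₂
  M-rowSum {r} r<n = begin
    ∑ n (Mℤ ns r)                        ≡⟨ ∑-cong n (λ c _ → sym (ℤₚ.*-identityʳ (Mℤ ns r c))) ⟩
    ∑ n (λ c → Mℤ ns r c * 1ℤ)           ≡⟨ M·x ns ns≥2 (λ _ → 1ℤ) r<n ⟩
    ∑ n (λ _ → 1ℤ) - (1ℤ + 1ℤ)           ≡⟨ cong (λ z → z - (1ℤ + 1ℤ)) (trans (∑-const n 1ℤ) (trans (ℤₚ.*-identityʳ (+ n)) n≡n₂+2)) ⟩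
    + n₂ + 1ℤ + 1ℤ - (1ℤ + 1ℤ)           ≡⟨ cancel (+ n₂) ⟩
    + n₂                                 ∎
    where
    open ≡-Reasoning
    cancel : ∀ a → a + 1ℤ + 1ℤ - (1ℤ + 1ℤ) ≡ a
    cancel = solve-∀

  totalArea : ∑ℕ k area ≡ n ℕ.* n₂
  totalArea = ℤₚ.+-injective (begin
    + ∑ℕ k area                                        ≡⟨ ∑-pos k area ⟨
    ∑ k (λ s → + area s)                              ≡⟨ ∑-cong k (λ s _ → trans (ℤₚ.pos-* (height s) (width s)) (product s)) ⟩
    ∑ k (λ s → ∑ n (λ r → ∑ n (λ c → + u r s * + v c s)))  ≡⟨ ∑-swap k n _ ⟩
    ∑ n (λ r → ∑ k (λ s → ∑ n (λ c → + u r s * + v c s)))  ≡⟨ ∑-cong n (λ r r<n → trans (∑-swap k n _) (∑-cong n (λ c c<n → sym (M≡UVᵀ r<n c<n)))) ⟩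
    ∑ n (λ r → ∑ n (Mℤ ns r))                          ≡⟨ ∑-cong n (λ r r<n → M-rowSum r<n) ⟩
    ∑ n (λ _ → + n₂)                                   ≡⟨ ∑-const n (+ n₂) ⟩
    + n * + n₂                                         ≡⟨ ℤₚ.pos-* n n₂ ⟨
    + (n ℕ.* n₂)                                       ∎)
    where
    open ≡-Reasoning
    product : ∀ s → + height s * + width s ≡ ∑ n (λ r → ∑ n (λ c → + u r s * + v c s))
    product s = begin
      + height s * + width s                              ≡⟨ cong₂ _*_ (∑-pos n (λ r → u r s)) (∑-pos n (λ c → v c s)) ⟨
      ∑ n (λ r → + u r s) * ∑ n (λ c → + v c s)           ≡⟨ ℤₚ.*-comm (∑ n (λ r → + u r s)) _ ⟩
      ∑ n (λ c → + v c s) * ∑ n (λ r → + u r s)           ≡⟨ ∑-*ˡ n (∑ n (λ c → + v c s)) (λ r → + u r s) ⟨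
      ∑ n (λ r → ∑ n (λ c → + v c s) * + u r s)           ≡⟨ ∑-cong n (λ r _ → trans (ℤₚ.*-comm _ (+ u r s)) (sym (∑-*ˡ n (+ u r s) _))) ⟩
      ∑ n (λ r → ∑ n (λ c → + u r s * + v c s))           ∎

  -- Every rectangle has area at least 2(n - 2) while M has n(n - 2) ones, so k ≤ n / 2 < n - m.
  allMatched-impossible : (∀ s → s < k → dot n (column s) (y s) ≡ D) → ⊥
  allMatched-impossible matched = ℕₚ.<⇒≱ (ℕₚ.<-≤-trans (ℕₚ.m<m+n (2 ℕ.* m) (s≤s z≤n)) big) n≤2m
    where
    instance
      n₂-nonZero : ℕ.NonZero n₂
      n₂-nonZero = ℕ.≢-nonZero n₂≢0
    k[n₂+n₂]≤n*n₂ : k ℕ.* (n₂ ℕ.+ n₂) ≤ n ℕ.* n₂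
    k[n₂+n₂]≤n*n₂ = subst (k ℕ.* (n₂ ℕ.+ n₂) ≤_) totalArea
                      (∑ℕ-lowerBound k area (n₂ ℕ.+ n₂) (λ s s<k → matched-area s<k (matched s s<k)))
    k+k≤n : k ℕ.+ k ≤ n
    k+k≤n = ℕₚ.*-cancelʳ-≤ (k ℕ.+ k) n n₂ (subst (_≤ n ℕ.* n₂) (regroup k n₂) k[n₂+n₂]≤n*n₂)
      where
      regroup : ∀ k n₂ → k ℕ.* (n₂ ℕ.+ n₂) ≡ (k ℕ.+ k) ℕ.* n₂
      regroup = solve-∀ℕ
    n≤2m : n ≤ 2 ℕ.* m
    n≤2m = ℕₚ.+-cancelˡ-≤ n n (2 ℕ.* m) (begin
      n ℕ.+ n                       ≤⟨ ℕₚ.+-mono-≤ rank-≤-columns rank-≤-columns ⟩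
      (k ℕ.+ m) ℕ.+ (k ℕ.+ m)       ≡⟨ regroup k m ⟩
      (k ℕ.+ k) ℕ.+ 2 ℕ.* m         ≤⟨ ℕₚ.+-monoˡ-≤ (2 ℕ.* m) k+k≤n ⟩
      n ℕ.+ 2 ℕ.* m                 ∎)
      where
      open ℕₚ.≤-Reasoning
      regroup : ∀ k m → (k ℕ.+ m) ℕ.+ (k ℕ.+ m) ≡ (k ℕ.+ k) ℕ.+ 2 ℕ.* m
      regroup = solve-∀ℕ

  balanced? : ∀ s → Dec (Balanced s)
  balanced? s = All.all? (λ a → dot n a (row s) ℤ.≟ 0ℤ) (leftKernelBasis ns)

  lowerBound : n ≤ (k ∸ 1) ℕ.+ m
  lowerBound with ℕₚ.anyUpTo? (λ t → ¬? (balanced? t)) k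
  ... | yes (t₀ , t₀<k , unbalanced) =
    unbalanced⇒ (proj₁ witness) t₀<k (proj₂ witness)
    where
    witness = All.lookupAny (leftKernelBasis-leftNull ns ns≥2 ns-even)
                (Allₚ.¬All⇒Any¬ (λ a → dot n a (row t₀) ℤ.≟ 0ℤ) _ unbalanced)
  ... | no ¬unbalanced with ℕₚ.anyUpTo? (λ s → ¬? (dot n (column s) (y s) ℤ.≟ D)) k
  ...   | yes (s₀ , s₀<k , mismatch) =
    mismatch⇒ s₀<k (decidable-stable (balanced? s₀) (λ ub → ¬unbalanced (s₀ , s₀<k , ub))) mismatch
  ...   | no ¬mismatch = ⊥-elim (allMatched-impossible (λ s s<k →
    decidable-stable (dot n (column s) (y s) ℤ.≟ D) (λ mm → ¬mismatch (s , s<k , mm))))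

module Partition where

  open import Data.Integer using (+_; _+_; _*_; _-_)
  open import Data.Bool.Properties using (not-¬)
  open import Data.List using (applyUpTo)
  open import Data.Vec using (tabulate; fromList)
  import Data.Vec.Properties as Vecₚ
  open Sums
  open BlockIndexing
  open ComplementMatrix

  -- Rows of the rectangle attached to the column pair {t, blockSuc t}.
  rowsRule : (sameBlock evenR evenT diagonal firstR : Bool) → Bool
  rowsRule true  evenR evenT diagonal _      = not (evenR xor evenT) ∧ not diagonal
  rowsRule false evenR true  _        firstR = evenR ∧ not firstR
  rowsRule false evenR false _        firstR = not evenR ∨ firstR

  complementary : ∀ a z → fromBool (a ∧ not z) + fromBool (not a ∨ z) ≡ 1ℤ
  complementary true  true  = refl
  complementary true  false = refl
  complementary false _     = refl

  -- Two consecutive columns c and blockPred c of one block are covered by complementary row sets.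
  rowsRule-pair : ∀ S er ec E₁ E₂ Z → (S ≡ false → E₁ ≡ false) → (S ≡ false → E₂ ≡ false) →
                  (E₁ ≡ true → er ≡ ec) → (E₂ ≡ true → er ≡ not ec) →
                  fromBool (rowsRule S er ec E₁ Z) + fromBool (rowsRule S er (not ec) E₂ Z) ≡ 1ℤ - (fromBool E₁ + fromBool E₂)
  rowsRule-pair false er true  E₁ E₂ Z off₁ off₂ _ _ rewrite off₁ refl | off₂ refl = complementary er Z
  rowsRule-pair false er false E₁ E₂ Z off₁ off₂ _ _ rewrite off₁ refl | off₂ refl =
    trans (ℤₚ.+-comm (fromBool (not er ∨ Z)) _) (complementary er Z)
  rowsRule-pair true er ec true  true  Z _ _ on₁ on₂ = ⊥-elim (not-¬ (on₁ refl) (on₂ refl))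
  rowsRule-pair true er true  true  false Z _ _ on₁ _ rewrite on₁ refl = refl
  rowsRule-pair true er false true  false Z _ _ on₁ _ rewrite on₁ refl = refl
  rowsRule-pair true er true  false true  Z _ _ _ on₂ rewrite on₂ refl = refl
  rowsRule-pair true er false false true  Z _ _ _ on₂ rewrite on₂ refl = refl
  rowsRule-pair true true  true  false false Z _ _ _ _ = refl
  rowsRule-pair true true  false false false Z _ _ _ _ = refl
  rowsRule-pair true false true  false false Z _ _ _ _ = refl
  rowsRule-pair true false false false false Z _ _ _ _ = refl

  rectRows : ∀ {m} → Vec ℕ m → ℕ → ℕ → Bool
  rectRows ns t r = rowsRule ⌊ blockIndex ns r ℕ.≟ blockIndex ns t ⌋ (isEven (offset ns r)) (isEven (offset ns t))
                             ⌊ r ℕ.≟ t ⌋ ⌊ offset ns r ℕ.≟ 0 ⌋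

  rectCols : ∀ {m} → Vec ℕ m → ℕ → ℕ → Bool
  rectCols ns t c = ⌊ c ℕ.≟ t ⌋ ∨ ⌊ c ℕ.≟ blockSuc ns t ⌋

  rectRows-pair : ∀ {m} (ns : Vec ℕ m) → VecAll.All (2 ≤_) ns → VecAll.All Even ns → ∀ {r c} → r < sumV ns → c < sumV ns →
                  fromBool (rectRows ns c r) + fromBool (rectRows ns (blockPred ns c) r) ≡ Mℤ ns r c
  rectRows-pair ns ns≥2 ns-even {r} {c} r<n c<n = begin
    fromBool (rectRows ns c r) + fromBool (rectRows ns (blockPred ns c) r)
      ≡⟨ cong (λ z → fromBool (rectRows ns c r) + fromBool z)
           (cong₂ (λ S ec → rowsRule S (isEven (offset ns r)) ec E₂ Z)
                  (cong (λ b → ⌊ blockIndex ns r ℕ.≟ b ⌋) (blockIndex-blockPred ns c<n))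
                  (isEven-offset-blockPred ns ns≥2 ns-even c<n)) ⟩
    fromBool (rowsRule S er ec E₁ Z) + fromBool (rowsRule S er (not ec) E₂ Z)
      ≡⟨ rowsRule-pair S er ec E₁ E₂ Z off₁ off₂ on₁ on₂ ⟩
    1ℤ - (δ r c + δ r (blockPred ns c))
      ≡⟨ Mℤ-column ns ns≥2 r<n c<n ⟨
    Mℤ ns r c ∎
    where
    open ≡-Reasoning
    S  = ⌊ blockIndex ns r ℕ.≟ blockIndex ns c ⌋
    er = isEven (offset ns r)
    ec = isEven (offset ns c)
    E₁ = ⌊ r ℕ.≟ c ⌋
    E₂ = ⌊ r ℕ.≟ blockPred ns c ⌋
    Z  = ⌊ offset ns r ℕ.≟ 0 ⌋
    off₁ : S ≡ false → E₁ ≡ false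
    off₁ S≡false with blockIndex ns r ℕ.≟ blockIndex ns c | r ℕ.≟ c
    ... | no _           | no _     = refl
    ... | no different   | yes refl = ⊥-elim (different refl)
    ... | yes _          | _ with S≡false
    ...   | ()
    off₂ : S ≡ false → E₂ ≡ false
    off₂ S≡false with blockIndex ns r ℕ.≟ blockIndex ns c | r ℕ.≟ blockPred ns c
    ... | no _           | no _      = refl
    ... | no different   | yes r≡c′ = ⊥-elim (different (trans (cong (blockIndex ns) r≡c′) (blockIndex-blockPred ns c<n)))
    ... | yes _          | _ with S≡false
    ...   | ()
    on₁ : E₁ ≡ true → er ≡ ec
    on₁ E₁≡true with r ℕ.≟ c
    ... | yes refl = refl
    ... | no _ with E₁≡true
    ...   | ()
    on₂ : E₂ ≡ true → er ≡ not ec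
    on₂ E₂≡true with r ℕ.≟ blockPred ns c
    ... | yes r≡c′ = trans (cong (isEven ∘ offset ns) r≡c′) (isEven-offset-blockPred ns ns≥2 ns-even c<n)
    ... | no _ with E₂≡true
    ...   | ()

  fromBool-∧ : ∀ a b → fromBool (a ∧ b) ≡ fromBool a * fromBool b
  fromBool-∧ true  b = sym (ℤₚ.*-identityˡ (fromBool b))
  fromBool-∧ false b = refl

  fromBool-∨-disjoint : ∀ a b → (a ≡ true → b ≡ false) → fromBool (a ∨ b) ≡ fromBool a + fromBool b
  fromBool-∨-disjoint true  true  disjoint with disjoint refl
  ... | ()
  fromBool-∨-disjoint true  false _ = refl
  fromBool-∨-disjoint false b     _ = sym (ℤₚ.+-identityˡ (fromBool b))

  rectCols-δ : ∀ {m} (ns : Vec ℕ m) → VecAll.All (2 ≤_) ns → ∀ {t} c → t < sumV ns →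
               fromBool (rectCols ns t c) ≡ δ c t + δ c (blockSuc ns t)
  rectCols-δ ns ns≥2 {t} c t<n = fromBool-∨-disjoint _ _ disjoint
    where
    disjoint : ⌊ c ℕ.≟ t ⌋ ≡ true → ⌊ c ℕ.≟ blockSuc ns t ⌋ ≡ false
    disjoint c≡t with c ℕ.≟ t | c ℕ.≟ blockSuc ns t
    ... | yes refl | yes c≡c′ = ⊥-elim (blockSuc-≢ ns ns≥2 t<n (sym c≡c′))
    ... | yes _    | no _     = refl
    ... | no _     | _ with c≡t
    ...   | ()

  ∑-rectCols : ∀ {m} (ns : Vec ℕ m) → VecAll.All (2 ≤_) ns → ∀ {c} → c < sumV ns → (h : ℕ → ℤ) →
               ∑ (sumV ns) (λ t → h t * fromBool (rectCols ns t c)) ≡ h c + h (blockPred ns c)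
  ∑-rectCols ns ns≥2 {c} c<n h = begin
    ∑ n (λ t → h t * fromBool (rectCols ns t c))
      ≡⟨ ∑-cong n (λ t t<n → trans (cong (h t *_) (rectCols-δ ns ns≥2 c t<n)) (ℤₚ.*-distribˡ-+ (h t) _ _)) ⟩
    ∑ n (λ t → h t * δ c t + h t * δ c (blockSuc ns t))
      ≡⟨ ∑-+ n _ _ ⟩
    ∑ n (λ t → h t * δ c t) + ∑ n (λ t → h t * δ c (blockSuc ns t))
      ≡⟨ cong₂ _+_ (∑-cong n (λ t _ → trans (ℤₚ.*-comm (h t) _) (cong (_* h t) (δ-sym c t))))
                   (∑-cong n (λ t _ → ℤₚ.*-comm (h t) _)) ⟩
    ∑ n (λ t → δ t c * h t) + ∑ n (λ t → δ c (blockSuc ns t) * h t)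
      ≡⟨ cong₂ _+_ (∑-δ n c h c<n) (∑-δ-blockSuc ns h c<n) ⟩
    h c + h (blockPred ns c) ∎
    where
    open ≡-Reasoning
    n = sumV ns

  -- The rectangles of the m column pairs {t, t + 1} with offset t = 0 all have the rows below, so they merge into one.
  mergedRows : ∀ {m} → Vec ℕ m → ℕ → Bool
  mergedRows ns r = isEven (offset ns r) ∧ not ⌊ offset ns r ℕ.≟ 0 ⌋

  mergedCols : ∀ {m} → Vec ℕ m → ℕ → Bool
  mergedCols ns c = ⌊ offset ns c ℕ.≟ 0 ⌋ ∨ ⌊ offset ns (blockPred ns c) ℕ.≟ 0 ⌋

  rectRows-first : ∀ {m} (ns : Vec ℕ m) {t} r → offset ns t ≡ 0 → rectRows ns t r ≡ mergedRows ns r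
  rectRows-first ns {t} r offset≡0 rewrite offset≡0 with blockIndex ns r ℕ.≟ blockIndex ns t
  ... | no _         = refl
  ... | yes sameBlock = cong₂ _∧_ (xor-true (isEven (offset ns r))) (cong not diagonal⇔first)
    where
    xor-true : ∀ b → not (b xor true) ≡ b
    xor-true true  = refl
    xor-true false = refl
    diagonal⇔first : ⌊ r ℕ.≟ t ⌋ ≡ ⌊ offset ns r ℕ.≟ 0 ⌋
    diagonal⇔first with r ℕ.≟ t | offset ns r ℕ.≟ 0
    ... | yes refl | yes _      = refl
    ... | yes refl | no ≢0      = ⊥-elim (≢0 offset≡0)
    ... | no r≢t   | yes first = ⊥-elim (r≢t (blockIndex-offset-injective ns r t sameBlock (trans first (sym offset≡0))))
    ... | no _     | no _       = refl

  isFirst isNonFirst : ∀ {m} → Vec ℕ m → ℕ → ℤ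
  isFirst    ns t = fromBool ⌊ offset ns t ℕ.≟ 0 ⌋
  isNonFirst ns t = fromBool (not ⌊ offset ns t ℕ.≟ 0 ⌋)

  isFirst+isNonFirst : ∀ {m} (ns : Vec ℕ m) t → isFirst ns t + isNonFirst ns t ≡ 1ℤ
  isFirst+isNonFirst ns t with offset ns t ℕ.≟ 0
  ... | yes _ = refl
  ... | no _  = refl

  merged-decomposition : ∀ {m} (ns : Vec ℕ m) → VecAll.All (2 ≤_) ns → ∀ r {c} → c < sumV ns →
    fromBool (mergedRows ns r ∧ mergedCols ns c) ≡
    ∑ (sumV ns) (λ t → isFirst ns t * (fromBool (rectRows ns t r) * fromBool (rectCols ns t c)))
  merged-decomposition ns ns≥2 r {c} c<n = sym (begin
    ∑ n (λ t → isFirst ns t * (fromBool (rectRows ns t r) * fromBool (rectCols ns t c)))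
      ≡⟨ ∑-cong n (λ t _ → sym (ℤₚ.*-assoc (isFirst ns t) _ _)) ⟩
    ∑ n (λ t → h t * fromBool (rectCols ns t c))
      ≡⟨ ∑-rectCols ns ns≥2 c<n h ⟩
    h c + h (blockPred ns c)
      ≡⟨ cong₂ _+_ (h≡ c) (h≡ (blockPred ns c)) ⟩
    isFirst ns c * rows + isFirst ns (blockPred ns c) * rows
      ≡⟨ ℤₚ.*-distribʳ-+ rows (isFirst ns c) _ ⟨
    (isFirst ns c + isFirst ns (blockPred ns c)) * rows
      ≡⟨ cong (_* rows) (fromBool-∨-disjoint _ _ disjoint) ⟨
    fromBool (mergedCols ns c) * rows
      ≡⟨ ℤₚ.*-comm (fromBool (mergedCols ns c)) rows ⟩
    rows * fromBool (mergedCols ns c)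
      ≡⟨ fromBool-∧ (mergedRows ns r) (mergedCols ns c) ⟨
    fromBool (mergedRows ns r ∧ mergedCols ns c) ∎)
    where
    open ≡-Reasoning
    n = sumV ns
    rows = fromBool (mergedRows ns r)
    h : ℕ → ℤ
    h t = isFirst ns t * fromBool (rectRows ns t r)
    h≡ : ∀ t → h t ≡ isFirst ns t * rows
    h≡ t with offset ns t ℕ.≟ 0
    ... | yes offset≡0 = cong (λ b → 1ℤ * fromBool b) (rectRows-first ns r offset≡0)
    ... | no _         = refl
    disjoint : ⌊ offset ns c ℕ.≟ 0 ⌋ ≡ true → ⌊ offset ns (blockPred ns c) ℕ.≟ 0 ⌋ ≡ false
    disjoint first with offset ns c ℕ.≟ 0 | offset ns (blockPred ns c) ℕ.≟ 0
    ... | yes c-first | yes pred-first with trans (sym c-first) (offset-blockPred≡0 ns ns≥2 c<n pred-first)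
    ...   | ()
    disjoint first | yes _ | no _ = refl
    disjoint first | no _  | _ with first
    ...   | ()

  ∑ₗ : List ℕ → (ℕ → ℤ) → ℤ
  ∑ₗ []      F = 0ℤ
  ∑ₗ (t ∷ l) F = F t + ∑ₗ l F

  ∑ₗ-map : ∀ (f : ℕ → ℕ) l F → ∑ₗ (map f l) F ≡ ∑ₗ l (F ∘ f)
  ∑ₗ-map f []      F = refl
  ∑ₗ-map f (t ∷ l) F = cong (λ z → F (f t) + z) (∑ₗ-map f l F)

  ∑ₗ-++ : ∀ l l′ F → ∑ₗ (l ++ l′) F ≡ ∑ₗ l F + ∑ₗ l′ F
  ∑ₗ-++ []      l′ F = sym (ℤₚ.+-identityˡ _)
  ∑ₗ-++ (t ∷ l) l′ F = trans (cong (λ z → F t + z) (∑ₗ-++ l l′ F)) (sym (ℤₚ.+-assoc (F t) _ _))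

  ∑ₗ-applyUpTo : ∀ (f : ℕ → ℕ) n F → ∑ₗ (applyUpTo f n) F ≡ ∑ n (F ∘ f)
  ∑ₗ-applyUpTo f zero    F = refl
  ∑ₗ-applyUpTo f (suc n) F = cong (λ z → F (f 0) + z) (∑ₗ-applyUpTo (f ∘ suc) n F)

  nonFirstIndices : ∀ {m} → Vec ℕ m → List ℕ
  nonFirstIndices []       = []
  nonFirstIndices (k ∷ ks) = applyUpTo suc (k ∸ 1) ++ map (k ℕ.+_) (nonFirstIndices ks)

  ∑ₗ-nonFirstIndices : ∀ {m} (ns : Vec ℕ m) → VecAll.All (2 ≤_) ns → ∀ F →
                       ∑ₗ (nonFirstIndices ns) F ≡ ∑ (sumV ns) (λ t → isNonFirst ns t * F t)
  ∑ₗ-nonFirstIndices []               []           F = refl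
  ∑ₗ-nonFirstIndices (suc k′ ∷ ks) (_ ∷ ks≥2) F = begin
    ∑ₗ (applyUpTo suc k′ ++ map (k ℕ.+_) (nonFirstIndices ks)) F
      ≡⟨ ∑ₗ-++ (applyUpTo suc k′) _ F ⟩
    ∑ₗ (applyUpTo suc k′) F + ∑ₗ (map (k ℕ.+_) (nonFirstIndices ks)) F
      ≡⟨ cong₂ _+_ (∑ₗ-applyUpTo suc k′ F)
                   (trans (∑ₗ-map (k ℕ.+_) (nonFirstIndices ks) F) (∑ₗ-nonFirstIndices ks ks≥2 (F ∘ (k ℕ.+_)))) ⟩
    ∑ k′ (F ∘ suc) + ∑ (sumV ks) (λ i → isNonFirst ks i * F (k ℕ.+ i))
      ≡⟨ cong (_+ ∑ (sumV ks) (λ i → isNonFirst ks i * F (k ℕ.+ i)))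
              (trans (∑-cong k′ (λ i _ → sym (ℤₚ.*-identityˡ (F (suc i))))) (sym (ℤₚ.+-identityˡ _))) ⟩
    ∑ k (λ t → fromBool (not ⌊ t ℕ.≟ 0 ⌋) * F t) + ∑ (sumV ks) (λ i → isNonFirst ks i * F (k ℕ.+ i))
      ≡⟨ ∑-split-cong k (sumV ks)
           (λ t t<k → cong (λ b → fromBool (not ⌊ (if b then t else offset ks (t ∸ k)) ℕ.≟ 0 ⌋) * F t) (<ᵇ-true t<k))
           (λ i → cong (λ o → fromBool (not ⌊ o ℕ.≟ 0 ⌋) * F (k ℕ.+ i)) (offset-shift k ks i)) ⟨
    ∑ (k ℕ.+ sumV ks) (λ t → isNonFirst (k ∷ ks) t * F t) ∎
    where
    open ≡-Reasoning
    k = suc k′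

  length-nonFirstIndices : ∀ {m} (ns : Vec ℕ m) → VecAll.All (2 ≤_) ns → length (nonFirstIndices ns) ℕ.+ m ≡ sumV ns
  length-nonFirstIndices []             []           = refl
  length-nonFirstIndices {suc m} (suc k′ ∷ ks) (_ ∷ ks≥2) = begin
    length (applyUpTo suc k′ ++ map (suc k′ ℕ.+_) (nonFirstIndices ks)) ℕ.+ suc m
      ≡⟨ cong (ℕ._+ suc m) (trans (Listₚ.length-++ (applyUpTo suc k′))
           (cong₂ ℕ._+_ (Listₚ.length-applyUpTo suc k′) (Listₚ.length-map (suc k′ ℕ.+_) (nonFirstIndices ks)))) ⟩
    (k′ ℕ.+ length (nonFirstIndices ks)) ℕ.+ suc m
      ≡⟨ ℕₚ.+-suc _ m ⟩
    suc ((k′ ℕ.+ length (nonFirstIndices ks)) ℕ.+ m)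
      ≡⟨ cong suc (trans (ℕₚ.+-assoc k′ _ m) (cong (k′ ℕ.+_) (length-nonFirstIndices ks ks≥2))) ⟩
    suc k′ ℕ.+ sumV ks ∎
    where open ≡-Reasoning

  rectangle : ∀ {n} → (ℕ → Bool) → (ℕ → Bool) → Rect n n
  rectangle rows cols = tabulate (rows ∘ toℕ) , tabulate (cols ∘ toℕ)

  inRect-rectangle : ∀ {n} rows cols (i j : Fin n) → inRect (rectangle rows cols) i j ≡ rows (toℕ i) ∧ cols (toℕ j)
  inRect-rectangle rows cols i j = cong₂ _∧_ (Vecₚ.lookup∘tabulate (rows ∘ toℕ) i) (Vecₚ.lookup∘tabulate (cols ∘ toℕ) j)

  cover-subst : ∀ {r c k k′} (eq : k ≡ k′) (Xs : Vec (Rect r c) k) i j → cover (subst (Vec (Rect r c)) eq Xs) i j ≡ cover Xs i j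
  cover-subst refl Xs i j = refl

  fromBool-if : ∀ b → + (if b then 1 else 0) ≡ fromBool b
  fromBool-if true  = refl
  fromBool-if false = refl

  module _ {m} (ns : Vec ℕ m) (ns≥2 : VecAll.All (2 ≤_) ns) (ns-even : VecAll.All Even ns) where

    private
      n = sumV ns

    rect : ℕ → Rect n n
    rect t = rectangle (rectRows ns t) (rectCols ns t)

    rectangles : List (Rect n n)
    rectangles = rectangle (mergedRows ns) (mergedCols ns) ∷ map rect (nonFirstIndices ns)

    length-rectangles : length rectangles ≡ n ∸ m ℕ.+ 1
    length-rectangles = begin
      suc (length (map rect (nonFirstIndices ns)))    ≡⟨ cong suc (Listₚ.length-map rect (nonFirstIndices ns)) ⟩
      suc (length (nonFirstIndices ns))               ≡⟨ ℕₚ.+-comm 1 _ ⟩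
      length (nonFirstIndices ns) ℕ.+ 1               ≡⟨ cong (ℕ._+ 1) (ℕₚ.m+n∸n≡m _ m) ⟨
      length (nonFirstIndices ns) ℕ.+ m ∸ m ℕ.+ 1     ≡⟨ cong (λ l → l ∸ m ℕ.+ 1) (length-nonFirstIndices ns ns≥2) ⟩
      n ∸ m ℕ.+ 1                                      ∎
      where open ≡-Reasoning

    cover-rects : ∀ l i j → + cover (fromList (map rect l)) i j ≡
                            ∑ₗ l (λ t → fromBool (rectRows ns t (toℕ i)) * fromBool (rectCols ns t (toℕ j)))
    cover-rects []      i j = refl
    cover-rects (t ∷ l) i j = trans (ℤₚ.pos-+ (if inRect (rect t) i j then 1 else 0) _)
      (cong₂ _+_ (trans (fromBool-if _) (trans (cong fromBool (inRect-rectangle (rectRows ns t) (rectCols ns t) i j))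
                                               (fromBool-∧ (rectRows ns t (toℕ i)) _)))
                 (cover-rects l i j))

    -- Counting with multiplicity, the rectangles through (r, c) are those of the pairs t = c and t = blockPred c.
    cover-rectangles : ∀ i j → + cover (fromList rectangles) i j ≡ Mℤ ns (toℕ i) (toℕ j)
    cover-rectangles i j = begin
      + cover (fromList rectangles) i j
        ≡⟨ ℤₚ.pos-+ (if inRect (rectangle {n} (mergedRows ns) (mergedCols ns)) i j then 1 else 0) _ ⟩
      + (if inRect (rectangle {n} (mergedRows ns) (mergedCols ns)) i j then 1 else 0) + + cover (fromList (map rect (nonFirstIndices ns))) i j
        ≡⟨ cong₂ _+_ (trans (fromBool-if _) (trans (cong fromBool (inRect-rectangle (mergedRows ns) (mergedCols ns) i j))
                                                   (merged-decomposition ns ns≥2 r c<n)))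
                     (trans (cover-rects (nonFirstIndices ns) i j) (∑ₗ-nonFirstIndices ns ns≥2 F)) ⟩
      ∑ n (λ t → isFirst ns t * F t) + ∑ n (λ t → isNonFirst ns t * F t)
        ≡⟨ ∑-+ n _ _ ⟨
      ∑ n (λ t → isFirst ns t * F t + isNonFirst ns t * F t)
        ≡⟨ ∑-cong n (λ t _ → trans (sym (ℤₚ.*-distribʳ-+ (F t) (isFirst ns t) _))
                                   (trans (cong (_* F t) (isFirst+isNonFirst ns t)) (ℤₚ.*-identityˡ (F t)))) ⟩
      ∑ n F
        ≡⟨ ∑-rectCols ns ns≥2 c<n (λ t → fromBool (rectRows ns t r)) ⟩
      fromBool (rectRows ns c r) + fromBool (rectRows ns (blockPred ns c) r)
        ≡⟨ rectRows-pair ns ns≥2 ns-even r<n c<n ⟩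
      Mℤ ns r c ∎
      where
      open ≡-Reasoning
      r = toℕ i
      c = toℕ j
      r<n = Finₚ.toℕ<n i
      c<n = Finₚ.toℕ<n j
      F : ℕ → ℤ
      F t = fromBool (rectRows ns t r) * fromBool (rectCols ns t c)

    partition : Σ[ Xs ∈ Vec (Rect n n) (n ∸ m ℕ.+ 1) ] IsPartition (complement (circBlockDiag2 ns)) Xs
    partition = subst (Vec (Rect n n)) length-rectangles (fromList rectangles) , λ i j →
      ℤₚ.+-injective (trans (cong +_ (cover-subst length-rectangles (fromList rectangles) i j))
                            (trans (cover-rectangles i j) (sym (fromBool-if _))))

module PartitionBound where

  open import Data.Integer using (+_; _+_; _*_)
  open Sums
  open ComplementMatrix using (Mℤ)

  member : ∀ {n} → Vec Bool n → ℕ → Bool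
  member []       _       = false
  member (b ∷ bs) zero    = b
  member (b ∷ bs) (suc r) = member bs r

  lookup≡member : ∀ {n} (bs : Vec Bool n) (i : Fin n) → Data.Vec.lookup bs i ≡ member bs (toℕ i)
  lookup≡member (b ∷ bs) Fin.zero    = refl
  lookup≡member (b ∷ bs) (Fin.suc i) = lookup≡member bs i

  indicator : Bool → ℕ
  indicator b = if b then 1 else 0

  indicator-∧ : ∀ a b → + indicator (a ∧ b) ≡ + indicator a * + indicator b
  indicator-∧ true  true  = refl
  indicator-∧ true  false = refl
  indicator-∧ false b     = refl

  -- The 0,1 matrices U (rows × rectangles) and V (columns × rectangles) with cover = U Vᵀ.
  rowsOf colsOf : ∀ {n k} → Vec (Rect n n) k → ℕ → ℕ → ℕ
  rowsOf []       r t       = 0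
  rowsOf (X ∷ Xs) r zero    = indicator (member (proj₁ X) r)
  rowsOf (X ∷ Xs) r (suc t) = rowsOf Xs r t
  colsOf []       c t       = 0
  colsOf (X ∷ Xs) c zero    = indicator (member (proj₂ X) c)
  colsOf (X ∷ Xs) c (suc t) = colsOf Xs c t

  cover≡∑ : ∀ {n k} (Xs : Vec (Rect n n) k) (i j : Fin n) →
            + cover Xs i j ≡ ∑ k (λ t → + rowsOf Xs (toℕ i) t * + colsOf Xs (toℕ j) t)
  cover≡∑ []             i j = refl
  cover≡∑ ((R , C) ∷ Xs) i j = trans (ℤₚ.pos-+ (indicator (Data.Vec.lookup R i ∧ Data.Vec.lookup C j)) (cover Xs i j))
    (cong₂ _+_ (trans (indicator-∧ (Data.Vec.lookup R i) (Data.Vec.lookup C j))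
                      (cong₂ (λ a b → + indicator a * + indicator b) (lookup≡member R i) (lookup≡member C j)))
               (cover≡∑ Xs i j))

  partition-factorises : ∀ {m} (ns : Vec ℕ m) {k} (Xs : Vec (Rect (sumV ns) (sumV ns)) k) →
    IsPartition (complement (circBlockDiag2 ns)) Xs → ∀ {r c} → r < sumV ns → c < sumV ns →
    Mℤ ns r c ≡ ∑ k (λ t → + rowsOf Xs r t * + colsOf Xs c t)
  partition-factorises ns {k} Xs is-partition r<n c<n =
    subst₂ (λ r c → Mℤ ns r c ≡ ∑ k (λ t → + rowsOf Xs r t * + colsOf Xs c t))
      (Finₚ.toℕ-fromℕ< r<n) (Finₚ.toℕ-fromℕ< c<n) (entry (fromℕ< r<n) (fromℕ< c<n))
    where
    entry : ∀ i j → Mℤ ns (toℕ i) (toℕ j) ≡ ∑ k (λ t → + rowsOf Xs (toℕ i) t * + colsOf Xs (toℕ j) t)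
    entry i j = trans (sym (fromBool-if (not (blockEntry ns (toℕ i) (toℕ j)))))
                      (trans (cong +_ (sym (is-partition i j))) (cover≡∑ Xs i j))
      where
      fromBool-if : ∀ b → + indicator b ≡ fromBool b
      fromBool-if true  = refl
      fromBool-if false = refl

  partition-size : ∀ {m} → 1 ≤ m → (ns : Vec ℕ m) → VecAll.All (2 ≤_) ns → VecAll.All BlockIndexing.Even ns →
    2 ℕ.* m ℕ.+ 2 ≤ sumV ns → ∀ k (Xs : Vec (Rect (sumV ns) (sumV ns)) k) →
    IsPartition (complement (circBlockDiag2 ns)) Xs → sumV ns ∸ m ℕ.+ 1 ≤ k
  partition-size {m} 1≤m ns ns≥2 ns-even big k Xs is-partition = rearrange k bound
    where
    open AreaArgument ns ns≥2 ns-even 1≤m big k (rowsOf Xs) (colsOf Xs) (partition-factorises ns Xs is-partition)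
      using () renaming (lowerBound to bound)
    rearrange : ∀ k → sumV ns ≤ (k ∸ 1) ℕ.+ m → sumV ns ∸ m ℕ.+ 1 ≤ k
    rearrange zero    n≤m = ⊥-elim (ℕₚ.<⇒≱ (ℕₚ.<-≤-trans (ℕₚ.≤-<-trans (ℕₚ.m≤n*m m 2) (ℕₚ.m<m+n (2 ℕ.* m) (s≤s z≤n))) big) n≤m)
    rearrange (suc k) n≤k+m = subst (_≤ suc k) (ℕₚ.+-comm 1 (sumV ns ∸ m))
      (s≤s (subst (sumV ns ∸ m ≤_) (ℕₚ.m+n∸n≡m k m) (ℕₚ.∸-monoˡ-≤ m n≤k+m)))

open import Data.Nat using (_+_; _*_)
open import Data.Nat.Divisibility using (_∣_; divides)
open import Data.Nat.Tactic.RingSolver using () renaming (solve-∀ to solve-∀ℕ)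
open import Data.Vec using (lookup)
import Data.Vec.Relation.Unary.All.Properties as VecAllₚ
open import Data.Product using (∃)

∣2⇒Even : ∀ {k} → 2 ∣ k → BlockIndexing.Even k
∣2⇒Even (divides q refl) = q , double q
  where
  double : ∀ q → q * 2 ≡ q + q
  double = solve-∀ℕ

∣2∧>2⇒≥4 : ∀ {k} → 2 ∣ k → 2 < k → 4 ≤ k
∣2∧>2⇒≥4 (divides 0 refl)             ()
∣2∧>2⇒≥4 (divides 1 refl)             (s≤s (s≤s ()))
∣2∧>2⇒≥4 (divides (suc (suc q)) refl) _ = s≤s (s≤s (s≤s (s≤s z≤n)))

sumV-≥ : ∀ {m} (ns : Vec ℕ m) → VecAll.All (2 ≤_) ns → 2 * m ≤ sumV ns
sumV-≥ []       []           = z≤n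
sumV-≥ {suc m} (k ∷ ks) (2≤k ∷ ks≥2) =
  subst (_≤ k + sumV ks) (sym (ℕₚ.*-distribˡ-+ 2 1 m)) (ℕₚ.+-mono-≤ 2≤k (sumV-≥ ks ks≥2))

sumV-≥-with-large-block : ∀ {m} (ns : Vec ℕ m) → VecAll.All (2 ≤_) ns → ∀ i → 4 ≤ lookup ns i → 2 * m + 2 ≤ sumV ns
sumV-≥-with-large-block {suc m} (k ∷ ks) (_ ∷ ks≥2) Fin.zero 4≤k =
  subst (_≤ k + sumV ks) (regroup m) (ℕₚ.+-mono-≤ 4≤k (sumV-≥ ks ks≥2))
  where
  regroup : ∀ m → 4 + 2 * m ≡ 2 * suc m + 2
  regroup = solve-∀ℕ
sumV-≥-with-large-block {suc m} (k ∷ ks) (2≤k ∷ ks≥2) (Fin.suc i) 4≤kᵢ =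
  subst (_≤ k + sumV ks) (regroup m) (ℕₚ.+-mono-≤ 2≤k (sumV-≥-with-large-block ks ks≥2 i 4≤kᵢ))
  where
  regroup : ∀ m → 2 + (2 * m + 2) ≡ 2 * suc m + 2
  regroup = solve-∀ℕ

theorem5p1 : (m : ℕ) → 1 ≤ m → (ns : Vec ℕ m) →
    (∀ i → 2 ≤ lookup ns i) → (∀ i → 2 ∣ lookup ns i) →
    (∃ λ (i : Fin m) → 2 < lookup ns i) →
    BinRankIs (complement (circBlockDiag2 ns)) (sumV ns ∸ m + 1)
theorem5p1 m 1≤m ns ns≥2 ns-even (i , 2<nᵢ) =
  Partition.partition ns blocks≥2 blocks-even ,
  PartitionBound.partition-size 1≤m ns blocks≥2 blocks-even
    (sumV-≥-with-large-block ns blocks≥2 i (∣2∧>2⇒≥4 (ns-even i) 2<nᵢ))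
  where
  blocks≥2 = VecAllₚ.lookup⁻ ns≥2
  blocks-even = VecAllₚ.lookup⁻ (∣2⇒Even ∘ ns-even)
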